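{- Let $\mathbb{F}_q$ be a finite field, $\mathcal{V}$ a vector space over $\mathbb{F}_q$, and $k,t$ integers with $0\le t\le k$ and $k\ge 2t$. Let $n\ge 3$ and let $\mathcal{C}=\{\pi_1,\ldots,\pi_n\}$ be a $(k,k-t)$-SCID in $\mathcal{V}$. Define $S:=\langle \pi_1,\ldots,\pi_n\rangle$ and $I:=\langle \pi_i\cap\pi_j \mid 1\le i<j\le n\rangle$. Then \[\dim S+\dim I\le 2k+2(n-2)t-(n-3).\]
   Context: A $(k,k-t)$-SCID is a set of (distinct) $k$-dimensional subspaces of $\mathcal{V}$, containing at least two elements, such that any two distinct members intersect in a subspace of dimension exactly $k-t$. $\langle\cdot\rangle$ denotes the span. -}

module Defs where

open import Level using (Level; _⊔_)
open import Data.Nat using (ℕ)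
open import Data.Fin using (Fin)
open import Data.List using (List; foldr)
open import Data.List.Relation.Unary.All using (All)
open import Data.Product using (Σ; ∃; _×_; _,_; proj₁; proj₂)
open import Relation.Nullary using (¬_)
open import Relation.Unary using (Pred)
open import Algebra.Bundles using (CommutativeRing)
open import Algebra.Module.Bundles using (Module)

IsField : ∀ {r ℓr} → CommutativeRing r ℓr → Set (r ⊔ ℓr)
IsField F = (¬ (0# ≈ 1#)) × (∀ x → ¬ (x ≈ 0#) → ∃ λ y → x * y ≈ 1#)
  where open CommutativeRing F

IsFinite : ∀ {r ℓr} → CommutativeRing r ℓr → Set (r ⊔ ℓr)
IsFinite F = ∃ λ (q : ℕ) → Σ (Fin q → Carrier) λ f → ∀ x → ∃ λ i → f i ≈ x
  where open CommutativeRing F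

module VectorSpace {r ℓr m ℓm} {F : CommutativeRing r ℓr} (V : Module F m ℓm) where
  open CommutativeRing F renaming (Carrier to K)
  open Module V

  record IsSubspace {ℓ} (P : Pred Carrierᴹ ℓ) : Set (r ⊔ m ⊔ ℓm ⊔ ℓ) where
    field
      resp  : ∀ {u v} → u ≈ᴹ v → P u → P v
      zero∈ : P 0ᴹ
      +∈    : ∀ {u v} → P u → P v → P (u +ᴹ v)
      *∈    : ∀ (c : K) {v} → P v → P (c *ₗ v)

  lincomb : ∀ {d} → (Fin d → K) → (Fin d → Carrierᴹ) → Carrierᴹ
  lincomb {ℕ.zero}  c b = 0ᴹ
  lincomb {ℕ.suc d} c b = (c Fin.zero *ₗ b Fin.zero) +ᴹ lincomb (λ i → c (Fin.suc i)) (λ i → b (Fin.suc i))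

  LinIndep : ∀ {d} → (Fin d → Carrierᴹ) → Set (r ⊔ ℓr ⊔ ℓm)
  LinIndep {d} b = ∀ (c : Fin d → K) → lincomb c b ≈ᴹ 0ᴹ → ∀ i → c i ≈ 0#

  HasDim : ∀ {ℓ} → Pred Carrierᴹ ℓ → ℕ → Set (r ⊔ ℓr ⊔ m ⊔ ℓm ⊔ ℓ)
  HasDim P d = Σ (Fin d → Carrierᴹ) λ b →
    (∀ i → P (b i)) × LinIndep b × (∀ v → P v → ∃ λ (c : Fin d → K) → v ≈ᴹ lincomb c b)

  lincombL : List (K × Carrierᴹ) → Carrierᴹ
  lincombL = foldr (λ cv acc → (proj₁ cv *ₗ proj₂ cv) +ᴹ acc) 0ᴹ

  Span : ∀ {ℓ} → Pred Carrierᴹ ℓ → Pred Carrierᴹ (r ⊔ m ⊔ ℓm ⊔ ℓ)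
  Span Q v = ∃ λ (xs : List (K × Carrierᴹ)) → All (λ cv → Q (proj₂ cv)) xs × v ≈ᴹ lincombL xs

  SameSet : ∀ {ℓ} → Pred Carrierᴹ ℓ → Pred Carrierᴹ ℓ → Set (m ⊔ ℓ)
  SameSet P Q = (∀ v → P v → Q v) × (∀ v → Q v → P v)

-- Write 𝒮 M = π₀ + ⋯ + π_{M-1}, 𝒥 M = Σ_{a<M} π_M ∩ π_a and ℐ M = Σ_{a<M} 𝒥 a, so that 𝒮 n = S and
-- ℐ n = I, and let c = k − t. Adding π_M to the first M members raises dim 𝒮 + dim ℐ by at most
-- k − dim X for every X ⊆ ℐ M ∩ 𝒥 M (Grassmann's formula twice, since 𝒥 M ⊆ 𝒮 M ∩ π_M). By induction
-- on M ≥ 2, dim 𝒮 M + dim ℐ M + (M − 2) ≤ 2k + 2(M − 2)t + 1, and even without the + 1 when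
-- π₀, …, π_{M-1} form a sunflower (each pairwise intersection lies in every member). For X take
-- π₀ ∩ π₁ when π_M joins a sunflower; (π_M ∩ π₀) ∩ (π₀ ∩ π₁), of dimension ≥ c − t, when only the
-- first M form one; and otherwise (π_M ∩ π_p) ∩ (π_p ∩ π_q + π_p ∩ π_o), of dimension ≥ c − t + 1,
-- for some v ∈ π_p ∩ π_q outside π_o. When t = 0 two members would coincide.
--
-- Equality in the field is not decidable, so bases, Steinitz exchange and dimension are only available
-- in the double-negation monad (independence and spanning hold up to ¬ ¬); this is harmless because
-- the inequality proved is ¬¬-stable.

module Submission where

open import Level using (Level; _⊔_; Lift; lift)
open import Data.Nat as ℕ using (ℕ; zero; suc; _≤_; _<_; z≤n; s≤s)
import Data.Nat.Properties as ℕₚ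
open import Data.Fin using (Fin; toℕ; fromℕ<; punchIn; _↑ˡ_; _↑ʳ_; splitAt)
  renaming (zero to fzero; suc to fsuc; _<_ to _<ᶠ_)
open import Data.Fin.Properties using (splitAt⁻¹-↑ˡ; splitAt⁻¹-↑ʳ; toℕ<n; toℕ-fromℕ<; fromℕ<-toℕ; fromℕ<-injective)
open import Data.Vec.Functional using (_∷_; _++_; tail; insertAt)
open import Data.Vec.Functional.Properties using (insertAt-lookup; insertAt-punchIn)
open import Data.Empty using (⊥-elim)
open import Data.List as List using ([]) renaming (_∷_ to _∷ᴸ_)
open import Data.List.Relation.Unary.All as All using (All; [])
import Data.List.Relation.Unary.All.Properties as All
open import Data.Sum using (inj₁; inj₂; [_,_])
open import Data.Product using (Σ; ∃; _×_; _,_; proj₁; proj₂)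
open import Function using (_∘_)
open import Relation.Nullary using (¬_; yes; no)
open import Relation.Nullary.Negation using (¬¬-map)
open import Relation.Nullary.Decidable using (decidable-stable; ¬¬-excluded-middle)
open import Relation.Unary using (Pred; _∩_)
open import Relation.Binary.PropositionalEquality as ≡ using (_≡_; _≢_)
open import Relation.Binary.Definitions using (tri<; tri≈; tri>)
open import Algebra.Bundles using (CommutativeRing; CommutativeMonoid)
open import Algebra.Module.Bundles using (Module)
import Algebra.Properties.Ring as RingProperties
import Algebra.Properties.CommutativeSemigroup as CommutativeSemigroupProperties
import Relation.Binary.Reasoning.Setoid as SetoidReasoning
import Algebra.Module.Properties as ModuleProperties
import Algebra.Properties.Group as GroupProperties
open import Algebra.Module.Construct.DirectProduct using (⟨module⟩)
open import Defs

private
  variable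
    ℓa ℓb ℓp : Level
    A : Set ℓa
    B : Set ℓb

infixl 1 _>>=_

pure : A → ¬ ¬ A
pure x ¬x = ¬x x

_>>=_ : ¬ ¬ A → (A → ¬ ¬ B) → ¬ ¬ B
(m >>= f) ¬b = m (λ x → f x ¬b)

¬¬-Π-Fin : ∀ {n} {P : Fin n → Set ℓp} → (∀ i → ¬ ¬ P i) → ¬ ¬ (∀ i → P i)
¬¬-Π-Fin {n = zero}  h = pure λ ()
¬¬-Π-Fin {n = suc n} h = do
  p₀ ← h fzero
  ps ← ¬¬-Π-Fin (h ∘ fsuc)
  pure λ { fzero → p₀ ; (fsuc i) → ps i }

¬∀⇒¬¬∃¬ : ∀ {n} {P : Fin n → Set ℓp} → ¬ (∀ i → P i) → ¬ ¬ (∃ λ i → ¬ P i)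
¬∀⇒¬¬∃¬ ¬∀ ¬∃ = ¬¬-Π-Fin (λ i ¬Pi → ¬∃ (i , ¬Pi)) ¬∀

¬¬-≤-stable : ∀ {m n} → ¬ ¬ (m ≤ n) → m ≤ n
¬¬-≤-stable = decidable-stable (_ ℕ.≤? _)

++-restrict : ∀ {p q} (e : Fin (p ℕ.+ q) → A) i → ((e ∘ (_↑ˡ q)) ++ (e ∘ (p ↑ʳ_))) i ≡ e i
++-restrict {p = p} {q} e i with splitAt p i in eq
... | inj₁ j = ≡.cong e (splitAt⁻¹-↑ˡ eq)
... | inj₂ j = ≡.cong e (splitAt⁻¹-↑ʳ eq)

tail-++ : ∀ {p q} (u : Fin (suc p) → A) (w : Fin q → A) i → tail (u ++ w) i ≡ (tail u ++ w) i
tail-++ {p = p} u w i with splitAt p i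
... | inj₁ j = ≡.refl
... | inj₂ j = ≡.refl

++-All : ∀ {p q} {P : A → Set ℓb} {u : Fin p → A} {w : Fin q → A} →
  (∀ i → P (u i)) → (∀ j → P (w j)) → ∀ k → P ((u ++ w) k)
++-All {p = p} Pu Pw k with splitAt p k
... | inj₁ i = Pu i
... | inj₂ j = Pw j

module _ {r ℓr} (F : CommutativeRing r ℓr) where

  open CommutativeRing F
  open RingProperties ring using (-‿distribˡ-*)
  open SetoidReasoning setoid

  α+-[α*ι]*β≈0 : ∀ α β ι → β * ι ≈ 1# → α + (- (α * ι)) * β ≈ 0#
  α+-[α*ι]*β≈0 α β ι βι≈1 = begin
    α + (- (α * ι)) * β ≈⟨ +-congˡ (sym (-‿distribˡ-* (α * ι) β)) ⟩
    α + - ((α * ι) * β) ≈⟨ +-congˡ (-‿cong (*-assoc α ι β)) ⟩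
    α + - (α * (ι * β)) ≈⟨ +-congˡ (-‿cong (*-congˡ (trans (*-comm ι β) βι≈1))) ⟩
    α + - (α * 1#)      ≈⟨ +-congˡ (-‿cong (*-identityʳ α)) ⟩
    α + - α             ≈⟨ -‿inverseʳ α ⟩
    0#                  ∎

module LinearAlgebra {r ℓr m ℓm} {F : CommutativeRing r ℓr} (isField : IsField F) (V : Module F m ℓm) where

  open CommutativeRing F renaming (Carrier to K; refl to K-refl; sym to K-sym; trans to K-trans) hiding (zero)
  open Module V
  open VectorSpace V public
  open CommutativeSemigroupProperties (CommutativeMonoid.commutativeSemigroup +ᴹ-commutativeMonoid)
    using (interchange; x∙yz≈y∙xz)
  open ModuleProperties V using (x≈0⇒x*y≈0; y≈0⇒x*y≈0)
  open GroupProperties +ᴹ-group using (inverseˡ-unique; inverseʳ-unique)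
  open SetoidReasoning ≈ᴹ-setoid

  _∈⟨_⟩ : ∀ {d} → Carrierᴹ → (Fin d → Carrierᴹ) → Set (r ⊔ ℓm)
  v ∈⟨ w ⟩ = ∃ λ c → v ≈ᴹ lincomb c w

  LinIndep¬¬ : ∀ {d} → (Fin d → Carrierᴹ) → Set (r ⊔ ℓr ⊔ ℓm)
  LinIndep¬¬ {d} b = ∀ (c : Fin d → K) → lincomb c b ≈ᴹ 0ᴹ → ∀ i → ¬ ¬ (c i ≈ 0#)

  HasDim¬¬ : ∀ {ℓ} → Pred Carrierᴹ ℓ → ℕ → Set (r ⊔ ℓr ⊔ m ⊔ ℓm ⊔ ℓ)
  HasDim¬¬ P d = Σ (Fin d → Carrierᴹ) λ b →
    (∀ i → P (b i)) × LinIndep¬¬ b × (∀ v → P v → ¬ ¬ (v ∈⟨ b ⟩))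

  HasDim⇒HasDim¬¬ : ∀ {ℓ} {P : Pred Carrierᴹ ℓ} {d} → HasDim P d → HasDim¬¬ P d
  HasDim⇒HasDim¬¬ (b , b∈P , indep , spans) =
    b , b∈P , (λ c eq i → pure (indep c eq i)) , (λ v v∈P → pure (spans v v∈P))

  δ : ∀ {d} → Fin d → Fin d → K
  δ fzero    fzero    = 1#
  δ fzero    (fsuc _) = 0#
  δ (fsuc _) fzero    = 0#
  δ (fsuc i) (fsuc j) = δ i j

  lincomb-cong : ∀ {d} {c c' : Fin d → K} {b b' : Fin d → Carrierᴹ} →
    (∀ i → c i ≈ c' i) → (∀ i → b i ≈ᴹ b' i) → lincomb c b ≈ᴹ lincomb c' b'
  lincomb-cong {zero}  c≈ b≈ = ≈ᴹ-refl
  lincomb-cong {suc d} c≈ b≈ = +ᴹ-cong (*ₗ-cong (c≈ fzero) (b≈ fzero)) (lincomb-cong (c≈ ∘ fsuc) (b≈ ∘ fsuc))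

  lincomb-zeroˡ : ∀ {d} {c : Fin d → K} (b : Fin d → Carrierᴹ) → (∀ i → c i ≈ 0#) → lincomb c b ≈ᴹ 0ᴹ
  lincomb-zeroˡ {zero}  b c≈0 = ≈ᴹ-refl
  lincomb-zeroˡ {suc d} b c≈0 = begin
    c₀b₀ +ᴹ lincomb _ (tail b) ≈⟨ +ᴹ-cong (x≈0⇒x*y≈0 (c≈0 fzero)) (lincomb-zeroˡ (tail b) (c≈0 ∘ fsuc)) ⟩
    0ᴹ +ᴹ 0ᴹ                   ≈⟨ +ᴹ-identityˡ 0ᴹ ⟩
    0ᴹ                         ∎
    where c₀b₀ = _ *ₗ b fzero

  lincomb-zeroʳ : ∀ {d} (c : Fin d → K) {b : Fin d → Carrierᴹ} → (∀ i → b i ≈ᴹ 0ᴹ) → lincomb c b ≈ᴹ 0ᴹ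
  lincomb-zeroʳ {zero}  c b≈0 = ≈ᴹ-refl
  lincomb-zeroʳ {suc d} c b≈0 = begin
    c fzero *ₗ _ +ᴹ lincomb (tail c) _ ≈⟨ +ᴹ-cong (y≈0⇒x*y≈0 (b≈0 fzero)) (lincomb-zeroʳ (tail c) (b≈0 ∘ fsuc)) ⟩
    0ᴹ +ᴹ 0ᴹ                           ≈⟨ +ᴹ-identityˡ 0ᴹ ⟩
    0ᴹ                                 ∎

  lincomb-+ˡ : ∀ {d} (c c' : Fin d → K) (b : Fin d → Carrierᴹ) →
    lincomb (λ i → c i + c' i) b ≈ᴹ lincomb c b +ᴹ lincomb c' b
  lincomb-+ˡ {zero}  c c' b = ≈ᴹ-sym (+ᴹ-identityˡ 0ᴹ)
  lincomb-+ˡ {suc d} c c' b = ≈ᴹ-trans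
    (+ᴹ-cong (*ₗ-distribʳ (b fzero) (c fzero) (c' fzero)) (lincomb-+ˡ (tail c) (tail c') (tail b)))
    (interchange _ _ _ _)

  lincomb-+ʳ : ∀ {d} (c : Fin d → K) (b b' : Fin d → Carrierᴹ) →
    lincomb c (λ i → b i +ᴹ b' i) ≈ᴹ lincomb c b +ᴹ lincomb c b'
  lincomb-+ʳ {zero}  c b b' = ≈ᴹ-sym (+ᴹ-identityˡ 0ᴹ)
  lincomb-+ʳ {suc d} c b b' = ≈ᴹ-trans
    (+ᴹ-cong (*ₗ-distribˡ (c fzero) (b fzero) (b' fzero)) (lincomb-+ʳ (tail c) (tail b) (tail b')))
    (interchange _ _ _ _)

  lincomb-*ˡ : ∀ {d} x (c : Fin d → K) (b : Fin d → Carrierᴹ) →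
    lincomb (λ i → x * c i) b ≈ᴹ x *ₗ lincomb c b
  lincomb-*ˡ {zero}  x c b = ≈ᴹ-sym (*ₗ-zeroʳ x)
  lincomb-*ˡ {suc d} x c b = ≈ᴹ-trans
    (+ᴹ-cong (*ₗ-assoc x (c fzero) (b fzero)) (lincomb-*ˡ x (tail c) (tail b)))
    (≈ᴹ-sym (*ₗ-distribˡ x _ _))

  lincomb-negʳ : ∀ {d} (c : Fin d → K) (b : Fin d → Carrierᴹ) →
    lincomb c (λ i → -ᴹ b i) ≈ᴹ -ᴹ lincomb c b
  lincomb-negʳ c b = inverseʳ-unique (lincomb c b) _ (begin
    lincomb c b +ᴹ lincomb c (λ i → -ᴹ b i) ≈⟨ lincomb-+ʳ c b _ ⟨
    lincomb c (λ i → b i +ᴹ -ᴹ b i)         ≈⟨ lincomb-zeroʳ c (λ i → -ᴹ‿inverseʳ (b i)) ⟩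
    0ᴹ                                      ∎)

  lincomb-negˡ : ∀ {d} (c : Fin d → K) (b : Fin d → Carrierᴹ) →
    lincomb (λ i → - c i) b ≈ᴹ -ᴹ lincomb c b
  lincomb-negˡ c b = inverseʳ-unique (lincomb c b) _ (begin
    lincomb c b +ᴹ lincomb (λ i → - c i) b ≈⟨ lincomb-+ˡ c _ b ⟨
    lincomb (λ i → c i + - c i) b         ≈⟨ lincomb-zeroˡ b (λ i → -‿inverseʳ (c i)) ⟩
    0ᴹ                                    ∎)

  lincomb-scaled : ∀ {d} (c g : Fin d → K) v → ∃ λ s → lincomb c (λ i → g i *ₗ v) ≈ᴹ s *ₗ v
  lincomb-scaled {zero}  c g v = 0# , ≈ᴹ-sym (*ₗ-zeroˡ v)
  lincomb-scaled {suc d} c g v with lincomb-scaled (tail c) (tail g) v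
  ... | s , eq = c fzero * g fzero + s , (begin
    c fzero *ₗ (g fzero *ₗ v) +ᴹ lincomb (tail c) _ ≈⟨ +ᴹ-cong (≈ᴹ-sym (*ₗ-assoc _ _ v)) eq ⟩
    (c fzero * g fzero) *ₗ v +ᴹ s *ₗ v              ≈⟨ *ₗ-distribʳ v _ s ⟨
    (c fzero * g fzero + s) *ₗ v                    ∎)

  lincomb-δ : ∀ {d} (b : Fin d → Carrierᴹ) i → lincomb (δ i) b ≈ᴹ b i
  lincomb-δ {suc d} b fzero = begin
    1# *ₗ b fzero +ᴹ lincomb (δ fzero ∘ fsuc) (tail b)
      ≈⟨ +ᴹ-cong (*ₗ-identityˡ _) (lincomb-zeroˡ (tail b) (λ _ → K-refl)) ⟩
    b fzero +ᴹ 0ᴹ                                      ≈⟨ +ᴹ-identityʳ _ ⟩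
    b fzero                                            ∎
  lincomb-δ {suc d} b (fsuc i) = begin
    0# *ₗ b fzero +ᴹ lincomb (δ i) (tail b) ≈⟨ +ᴹ-cong (*ₗ-zeroˡ _) (lincomb-δ (tail b) i) ⟩
    0ᴹ +ᴹ b (fsuc i)                        ≈⟨ +ᴹ-identityˡ _ ⟩
    b (fsuc i)                              ∎

  lincomb-punchIn : ∀ {d} (c : Fin (suc d) → K) (b : Fin (suc d) → Carrierᴹ) j →
    lincomb c b ≈ᴹ c j *ₗ b j +ᴹ lincomb (c ∘ punchIn j) (b ∘ punchIn j)
  lincomb-punchIn         c b fzero    = ≈ᴹ-refl
  lincomb-punchIn {suc d} c b (fsuc j) = begin
    x +ᴹ lincomb (tail c) (tail b) ≈⟨ +ᴹ-congˡ (lincomb-punchIn (tail c) (tail b) j) ⟩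
    x +ᴹ (y +ᴹ z)                  ≈⟨ x∙yz≈y∙xz x y z ⟩
    y +ᴹ (x +ᴹ z)                  ∎
    where x = c fzero *ₗ b fzero
          y = c (fsuc j) *ₗ b (fsuc j)
          z = lincomb (c ∘ fsuc ∘ punchIn j) (b ∘ fsuc ∘ punchIn j)

  lincomb-tail : ∀ {d} (c : Fin (suc d) → K) (w : Fin (suc d) → Carrierᴹ) → c fzero ≈ 0# →
    lincomb c w ≈ᴹ lincomb (tail c) (tail w)
  lincomb-tail c w c₀≈0 = ≈ᴹ-trans (+ᴹ-congʳ (x≈0⇒x*y≈0 c₀≈0)) (+ᴹ-identityˡ _)

  lincomb-++ : ∀ {p q} (c : Fin p → K) (c' : Fin q → K) (u : Fin p → Carrierᴹ) (w : Fin q → Carrierᴹ) →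
    lincomb (c ++ c') (u ++ w) ≈ᴹ lincomb c u +ᴹ lincomb c' w
  lincomb-++ {zero}  c c' u w = ≈ᴹ-sym (+ᴹ-identityˡ _)
  lincomb-++ {suc p} c c' u w = begin
    c fzero *ₗ u fzero +ᴹ lincomb (tail (c ++ c')) (tail (u ++ w))
      ≈⟨ +ᴹ-congˡ (lincomb-cong (reflexive ∘ tail-++ c c') (≈ᴹ-reflexive ∘ tail-++ u w)) ⟩
    c fzero *ₗ u fzero +ᴹ lincomb (tail c ++ c') (tail u ++ w)
      ≈⟨ +ᴹ-congˡ (lincomb-++ (tail c) c' (tail u) w) ⟩
    c fzero *ₗ u fzero +ᴹ (lincomb (tail c) (tail u) +ᴹ lincomb c' w)
      ≈⟨ +ᴹ-assoc _ _ _ ⟨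
    lincomb c u +ᴹ lincomb c' w ∎

  ∈⟨++⟩ : ∀ {p q} {u : Fin p → Carrierᴹ} {w : Fin q → Carrierᴹ} c c' {v} →
    v ≈ᴹ lincomb c u +ᴹ lincomb c' w → v ∈⟨ u ++ w ⟩
  ∈⟨++⟩ {u = u} {w} c c' v≈ = c ++ c' , ≈ᴹ-trans v≈ (≈ᴹ-sym (lincomb-++ c c' u w))

  LinIndep¬¬-++ : ∀ {p q} {u : Fin p → Carrierᴹ} {w : Fin q → Carrierᴹ} →
    (∀ c c' → lincomb c u +ᴹ lincomb c' w ≈ᴹ 0ᴹ → (∀ i → ¬ ¬ (c i ≈ 0#)) × (∀ j → ¬ ¬ (c' j ≈ 0#))) →
    LinIndep¬¬ (u ++ w)
  LinIndep¬¬-++ {p} {q} {u} {w} halves e e≈0 k =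
    ≡.subst (λ x → ¬ ¬ (x ≈ 0#)) (++-restrict {p = p} {q} e k) (on-halves (splitAt p k))
    where
    c  = e ∘ (_↑ˡ q)
    c' = e ∘ (p ↑ʳ_)
    c≈0 = halves c c' (begin
      lincomb c u +ᴹ lincomb c' w ≈⟨ lincomb-++ c c' u w ⟨
      lincomb (c ++ c') (u ++ w)  ≈⟨ lincomb-cong (reflexive ∘ ++-restrict {p = p} {q} e) (λ _ → ≈ᴹ-refl) ⟩
      lincomb e (u ++ w)          ≈⟨ e≈0 ⟩
      0ᴹ                          ∎)
    on-halves : ∀ s → ¬ ¬ ([ c , c' ] s ≈ 0#)
    on-halves (inj₁ i) = proj₁ c≈0 i
    on-halves (inj₂ j) = proj₂ c≈0 j

  *ₗ-negˡ : ∀ x v → (- x) *ₗ v ≈ᴹ -ᴹ (x *ₗ v)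
  *ₗ-negˡ x v = inverseʳ-unique (x *ₗ v) _ (begin
    x *ₗ v +ᴹ (- x) *ₗ v ≈⟨ *ₗ-distribʳ v x (- x) ⟨
    (x + - x) *ₗ v       ≈⟨ x≈0⇒x*y≈0 (-‿inverseʳ x) ⟩
    0ᴹ                   ∎)

  *ₗ-negʳ : ∀ x v → x *ₗ (-ᴹ v) ≈ᴹ -ᴹ (x *ₗ v)
  *ₗ-negʳ x v = inverseʳ-unique (x *ₗ v) _ (begin
    x *ₗ v +ᴹ x *ₗ (-ᴹ v) ≈⟨ *ₗ-distribˡ x v (-ᴹ v) ⟨
    x *ₗ (v +ᴹ -ᴹ v)      ≈⟨ y≈0⇒x*y≈0 (-ᴹ‿inverseʳ v) ⟩
    0ᴹ                    ∎)

  -ᴹ-∈ : ∀ {ℓ} {P : Pred Carrierᴹ ℓ} → IsSubspace P → ∀ {v} → P v → P (-ᴹ v)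
  -ᴹ-∈ P-sub {v} v∈P = resp (≈ᴹ-trans (*ₗ-negˡ 1# v) (-ᴹ‿cong (*ₗ-identityˡ v))) (*∈ (- 1#) v∈P)
    where open IsSubspace P-sub

  lincomb-∈ : ∀ {ℓ} {P : Pred Carrierᴹ ℓ} → IsSubspace P →
    ∀ {d} (c : Fin d → K) {u : Fin d → Carrierᴹ} → (∀ i → P (u i)) → P (lincomb c u)
  lincomb-∈ P-sub {zero}  c u∈P = IsSubspace.zero∈ P-sub
  lincomb-∈ P-sub {suc d} c u∈P =
    IsSubspace.+∈ P-sub (IsSubspace.*∈ P-sub (c fzero) (u∈P fzero)) (lincomb-∈ P-sub (tail c) (u∈P ∘ fsuc))

  ⟨⟩⊆ : ∀ {ℓ} {P : Pred Carrierᴹ ℓ} → IsSubspace P →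
    ∀ {d} {u : Fin d → Carrierᴹ} → (∀ i → P (u i)) → ∀ {v} → v ∈⟨ u ⟩ → P v
  ⟨⟩⊆ P-sub u∈P (c , v≈) = IsSubspace.resp P-sub (≈ᴹ-sym v≈) (lincomb-∈ P-sub c u∈P)

  δ-diagonal : ∀ {d} (i : Fin d) → δ i i ≡ 1#
  δ-diagonal fzero    = ≡.refl
  δ-diagonal (fsuc i) = δ-diagonal i

  LinIndep¬¬⇒≉0 : ∀ {d} {u : Fin d → Carrierᴹ} → LinIndep¬¬ u → ∀ i → ¬ (u i ≈ᴹ 0ᴹ)
  LinIndep¬¬⇒≉0 {u = u} indep i uᵢ≈0 =
    indep (δ i) (≈ᴹ-trans (lincomb-δ u i) uᵢ≈0) i
      (λ δᵢᵢ≈0 → proj₁ isField (K-trans (K-sym δᵢᵢ≈0) (reflexive (δ-diagonal i))))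

  eliminate : ∀ {α β ι} w₀ x y → β * ι ≈ 1# →
    (α *ₗ w₀ +ᴹ x) +ᴹ (- (α * ι)) *ₗ (β *ₗ w₀ +ᴹ y) ≈ᴹ x +ᴹ (- (α * ι)) *ₗ y
  eliminate {α} {β} {ι} w₀ x y βι≈1 = begin
    (α *ₗ w₀ +ᴹ x) +ᴹ γ *ₗ (β *ₗ w₀ +ᴹ y)       ≈⟨ +ᴹ-congˡ (*ₗ-distribˡ γ _ y) ⟩
    (α *ₗ w₀ +ᴹ x) +ᴹ (γ *ₗ (β *ₗ w₀) +ᴹ γ *ₗ y) ≈⟨ interchange _ x _ _ ⟩
    (α *ₗ w₀ +ᴹ γ *ₗ (β *ₗ w₀)) +ᴹ (x +ᴹ γ *ₗ y) ≈⟨ +ᴹ-congʳ (+ᴹ-congˡ (*ₗ-assoc γ β w₀)) ⟨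
    (α *ₗ w₀ +ᴹ (γ * β) *ₗ w₀) +ᴹ (x +ᴹ γ *ₗ y)  ≈⟨ +ᴹ-congʳ (*ₗ-distribʳ w₀ α (γ * β)) ⟨
    (α + γ * β) *ₗ w₀ +ᴹ (x +ᴹ γ *ₗ y)           ≈⟨ +ᴹ-congʳ (x≈0⇒x*y≈0 (α+-[α*ι]*β≈0 F α β ι βι≈1)) ⟩
    0ᴹ +ᴹ (x +ᴹ γ *ₗ y)                          ≈⟨ +ᴹ-identityˡ _ ⟩
    x +ᴹ γ *ₗ y                                  ∎
    where γ = - (α * ι)

  LinIndep¬¬-shear : ∀ {a} {u : Fin (suc a) → Carrierᴹ} → LinIndep¬¬ u → ∀ j (g : Fin a → K) →
    LinIndep¬¬ (λ i → u (punchIn j i) +ᴹ g i *ₗ u j)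
  LinIndep¬¬-shear {u = u} indep j g d d≈0 i =
    ≡.subst (λ x → ¬ ¬ (x ≈ 0#)) (insertAt-punchIn d j s i) (indep e e≈0 (punchIn j i))
    where
    s = proj₁ (lincomb-scaled d g (u j))
    e = insertAt d j s
    e≈0 : lincomb e u ≈ᴹ 0ᴹ
    e≈0 = begin
      lincomb e u                                              ≈⟨ lincomb-punchIn e u j ⟩
      e j *ₗ u j +ᴹ lincomb (e ∘ punchIn j) (u ∘ punchIn j)
        ≈⟨ +ᴹ-cong (*ₗ-congʳ (reflexive (insertAt-lookup d j s)))
                   (lincomb-cong (reflexive ∘ insertAt-punchIn d j s) (λ _ → ≈ᴹ-refl)) ⟩
      s *ₗ u j +ᴹ lincomb d (u ∘ punchIn j)                    ≈⟨ +ᴹ-comm _ _ ⟩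
      lincomb d (u ∘ punchIn j) +ᴹ s *ₗ u j                    ≈⟨ +ᴹ-congˡ (proj₂ (lincomb-scaled d g (u j))) ⟨
      lincomb d (u ∘ punchIn j) +ᴹ lincomb d (λ i → g i *ₗ u j) ≈⟨ lincomb-+ʳ d _ _ ⟨
      lincomb d (λ i → u (punchIn j i) +ᴹ g i *ₗ u j)          ≈⟨ d≈0 ⟩
      0ᴹ                                                       ∎

  eliminate-pivot : ∀ {a b} (w : Fin (suc b) → Carrierᴹ) {u : Fin (suc a) → Carrierᴹ} → LinIndep¬¬ u →
    (c : Fin (suc a) → Fin (suc b) → K) → (∀ i → u i ≈ᴹ lincomb (c i) w) → ∀ j → ¬ (c j fzero ≈ 0#) →
    ∃ λ (u' : Fin a → Carrierᴹ) → LinIndep¬¬ u' × (∀ i → u' i ∈⟨ tail w ⟩)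
  eliminate-pivot w {u} indep c u≈ j cⱼ₀≉0 =
    (λ i → u (punchIn j i) +ᴹ g i *ₗ u j) , LinIndep¬¬-shear {u = u} indep j g , u'∈
    where
    ι = proj₁ (proj₂ isField (c j fzero) cⱼ₀≉0)
    g = λ i → - (c (punchIn j i) fzero * ι)
    u'∈ : ∀ i → (u (punchIn j i) +ᴹ g i *ₗ u j) ∈⟨ tail w ⟩
    u'∈ i = (λ l → tail (c (punchIn j i)) l + g i * tail (c j) l) , (begin
      u (punchIn j i) +ᴹ g i *ₗ u j
        ≈⟨ +ᴹ-cong (u≈ (punchIn j i)) (*ₗ-congˡ (u≈ j)) ⟩
      lincomb (c (punchIn j i)) w +ᴹ g i *ₗ lincomb (c j) w
        ≈⟨ eliminate (w fzero) _ _ (proj₂ (proj₂ isField (c j fzero) cⱼ₀≉0)) ⟩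
      lincomb (tail (c (punchIn j i))) (tail w) +ᴹ g i *ₗ lincomb (tail (c j)) (tail w)
        ≈⟨ +ᴹ-congˡ (lincomb-*ˡ (g i) (tail (c j)) (tail w)) ⟨
      lincomb (tail (c (punchIn j i))) (tail w) +ᴹ lincomb (λ l → g i * tail (c j) l) (tail w)
        ≈⟨ lincomb-+ˡ _ _ (tail w) ⟨
      lincomb (λ l → tail (c (punchIn j i)) l + g i * tail (c j) l) (tail w) ∎)

  independent≤spanning : ∀ {a b} (w : Fin b → Carrierᴹ) {u : Fin a → Carrierᴹ} →
    LinIndep¬¬ u → (∀ i → ¬ ¬ (u i ∈⟨ w ⟩)) → ¬ ¬ (a ≤ b)
  independent≤spanning {zero}          w indep u∈⟨w⟩ = pure z≤n
  independent≤spanning {suc a} {zero}  w {u} indep u∈⟨w⟩ = do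
    (_ , u₀≈0) ← u∈⟨w⟩ fzero
    λ _ → LinIndep¬¬⇒≉0 {u = u} indep fzero u₀≈0
  independent≤spanning {suc a} {suc b} w {u} indep u∈⟨w⟩ = do
    spans ← ¬¬-Π-Fin u∈⟨w⟩
    let c = proj₁ ∘ spans
    yes no-w₀ ← ¬¬-excluded-middle {A = ∀ i → c i fzero ≈ 0#}
      where no some-w₀ → do
              (j , cⱼ₀≉0) ← ¬∀⇒¬¬∃¬ some-w₀
              let (u' , indep' , u'∈) = eliminate-pivot w indep c (proj₂ ∘ spans) j cⱼ₀≉0
              a≤b ← independent≤spanning (tail w) indep' (pure ∘ u'∈)
              pure (s≤s a≤b)
    1+a≤b ← independent≤spanning (tail w) indep
      (λ i → pure (tail (c i) , ≈ᴹ-trans (proj₂ (spans i)) (lincomb-tail (c i) w (no-w₀ i))))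
    pure (ℕₚ.m≤n⇒m≤1+n 1+a≤b)

  solve-for : ∀ {x ι} v w → x * ι ≈ 1# → x *ₗ v +ᴹ w ≈ᴹ 0ᴹ → v ≈ᴹ (- ι) *ₗ w
  solve-for {x} {ι} v w xι≈1 xv+w≈0 = begin
    v                 ≈⟨ *ₗ-identityˡ v ⟨
    1# *ₗ v           ≈⟨ *ₗ-congʳ (K-trans (*-comm ι x) xι≈1) ⟨
    (ι * x) *ₗ v      ≈⟨ *ₗ-assoc ι x v ⟩
    ι *ₗ (x *ₗ v)     ≈⟨ *ₗ-congˡ (inverseˡ-unique (x *ₗ v) w xv+w≈0) ⟩
    ι *ₗ (-ᴹ w)       ≈⟨ *ₗ-negʳ ι w ⟩
    -ᴹ (ι *ₗ w)       ≈⟨ *ₗ-negˡ ι w ⟨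
    (- ι) *ₗ w        ∎

  LinIndep¬¬-∷ : ∀ {d} {u : Fin d → Carrierᴹ} {v} → LinIndep¬¬ u → ¬ (v ∈⟨ u ⟩) → LinIndep¬¬ (v ∷ u)
  LinIndep¬¬-∷ {u = u} {v} indep v∉⟨u⟩ c c·vu≈0 i = do
    yes c₀≈0 ← ¬¬-excluded-middle {A = c fzero ≈ 0#}
      where no c₀≉0 → λ _ → v∉⟨u⟩ (v∈⟨u⟩ c₀≉0)
    c≈0 c₀≈0 i
    where
    v∈⟨u⟩ : ¬ (c fzero ≈ 0#) → v ∈⟨ u ⟩
    v∈⟨u⟩ c₀≉0 = (λ k → - ι * c (fsuc k)) ,
      ≈ᴹ-trans (solve-for v _ (proj₂ (proj₂ isField _ c₀≉0)) c·vu≈0) (≈ᴹ-sym (lincomb-*ˡ (- ι) (tail c) u))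
      where ι = proj₁ (proj₂ isField _ c₀≉0)
    c≈0 : c fzero ≈ 0# → ∀ i → ¬ ¬ (c i ≈ 0#)
    c≈0 c₀≈0 fzero    = pure c₀≈0
    c≈0 c₀≈0 (fsuc k) = indep (tail c) (≈ᴹ-trans (≈ᴹ-sym (lincomb-tail c (v ∷ u) c₀≈0)) c·vu≈0) k

  ⊆span⇒¬¬HasDim¬¬ : ∀ {ℓ} (P : Pred Carrierᴹ ℓ) {b} (w : Fin b → Carrierᴹ) →
    (∀ v → P v → ¬ ¬ (v ∈⟨ w ⟩)) → ¬ ¬ ∃ (HasDim¬¬ P)
  ⊆span⇒¬¬HasDim¬¬ P {b} w P⊆⟨w⟩ = extend b (λ ()) (λ ()) (λ _ _ ()) (ℕₚ.≤-reflexive (≡.sym (ℕₚ.+-identityʳ b)))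
    where
    extend : ∀ fuel {a} (u : Fin a → Carrierᴹ) → (∀ i → P (u i)) → LinIndep¬¬ u → b ≤ fuel ℕ.+ a →
      ¬ ¬ ∃ (HasDim¬¬ P)
    extend fuel {a} u u∈P indep b≤ = do
      no ¬spans ← ¬¬-excluded-middle {A = ∀ v → P v → ¬ ¬ (v ∈⟨ u ⟩)}
        where yes spans → pure (a , u , u∈P , indep , spans)
      (v , v∈P , v∉⟨u⟩) ← (λ ¬new → ¬spans (λ v v∈P v∉⟨u⟩ → ¬new (v , v∈P , v∉⟨u⟩)))
      let indep' = LinIndep¬¬-∷ indep v∉⟨u⟩
          vu∈P   = λ { fzero → v∈P ; (fsuc i) → u∈P i }
      a<b ← independent≤spanning w indep' (λ i → P⊆⟨w⟩ _ (vu∈P i))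
      continue fuel (v ∷ u) vu∈P indep' a<b b≤
      where
      continue : ∀ fuel (u' : Fin (suc a) → Carrierᴹ) → (∀ i → P (u' i)) → LinIndep¬¬ u' →
        a < b → b ≤ fuel ℕ.+ a → ¬ ¬ ∃ (HasDim¬¬ P)
      continue zero       u' u'∈P indep' a<b b≤a  = λ _ → ℕₚ.<-irrefl ≡.refl (ℕₚ.<-≤-trans a<b b≤a)
      continue (suc fuel) u' u'∈P indep' a<b b≤ =
        extend fuel u' u'∈P indep' (ℕₚ.≤-trans b≤ (ℕₚ.≤-reflexive (≡.sym (ℕₚ.+-suc fuel a))))

  dim-mono : ∀ {ℓ ℓ'} {P : Pred Carrierᴹ ℓ} {Q : Pred Carrierᴹ ℓ'} {α β} →
    (∀ v → P v → ¬ ¬ Q v) → HasDim¬¬ P α → HasDim¬¬ Q β → ¬ ¬ (α ≤ β)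
  dim-mono P⊆Q (bP , bP∈P , indepP , _) (bQ , _ , _ , Q⊆⟨bQ⟩) =
    independent≤spanning bQ indepP (λ i → P⊆Q _ (bP∈P i) >>= Q⊆⟨bQ⟩ _)

  dim-strict : ∀ {ℓ ℓ'} {P : Pred Carrierᴹ ℓ} {Q : Pred Carrierᴹ ℓ'} {α β} → IsSubspace P →
    (∀ v → P v → ¬ ¬ Q v) → ∀ {x} → Q x → ¬ P x → HasDim¬¬ P α → HasDim¬¬ Q β → ¬ ¬ (α < β)
  dim-strict {Q = Q} P-sub P⊆Q {x} x∈Q x∉P (bP , bP∈P , indepP , _) (bQ , _ , _ , Q⊆⟨bQ⟩) =
    independent≤spanning bQ (LinIndep¬¬-∷ indepP (x∉P ∘ ⟨⟩⊆ P-sub bP∈P)) (λ i → x∷bP∈Q i >>= Q⊆⟨bQ⟩ _)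
    where
    x∷bP∈Q : ∀ i → ¬ ¬ Q ((x ∷ bP) i)
    x∷bP∈Q fzero    = pure x∈Q
    x∷bP∈Q (fsuc i) = P⊆Q _ (bP∈P i)

  dim-equal⇒⊇ : ∀ {ℓ ℓ'} {P : Pred Carrierᴹ ℓ} {Q : Pred Carrierᴹ ℓ'} {d} → IsSubspace P →
    (∀ v → P v → Q v) → HasDim¬¬ P d → HasDim Q d → ¬ ¬ (∀ v → Q v → P v)
  dim-equal⇒⊇ {P = P} P-sub P⊆Q dimP (bQ , bQ∈Q , indepQ , Q⊆⟨bQ⟩) = do
    bQ∈P ← ¬¬-Π-Fin bQᵢ∈P
    pure λ v v∈Q → ⟨⟩⊆ P-sub bQ∈P (Q⊆⟨bQ⟩ v v∈Q)
    where
    bQᵢ∈P : ∀ i → ¬ ¬ P (bQ i)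
    bQᵢ∈P i bQᵢ∉P = dim-strict P-sub (λ v → pure ∘ P⊆Q v) (bQ∈Q i) bQᵢ∉P dimP
      (HasDim⇒HasDim¬¬ (bQ , bQ∈Q , indepQ , Q⊆⟨bQ⟩)) (ℕₚ.<-irrefl ≡.refl)

  HasDim¬¬-resp : ∀ {ℓ} {P Q : Pred Carrierᴹ ℓ} {d} → SameSet P Q → HasDim¬¬ P d → HasDim¬¬ Q d
  HasDim¬¬-resp (P⊆Q , Q⊆P) (b , b∈P , indep , spans) = b , (λ i → P⊆Q _ (b∈P i)) , indep , (λ v → spans v ∘ Q⊆P v)

  IsSubspace-resp : ∀ {ℓ} {P Q : Pred Carrierᴹ ℓ} → SameSet P Q → IsSubspace P → IsSubspace Q
  IsSubspace-resp (P⊆Q , Q⊆P) P-sub = record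
    { resp  = λ u≈v → P⊆Q _ ∘ resp u≈v ∘ Q⊆P _
    ; zero∈ = P⊆Q _ zero∈
    ; +∈    = λ u∈Q v∈Q → P⊆Q _ (+∈ (Q⊆P _ u∈Q) (Q⊆P _ v∈Q))
    ; *∈    = λ c v∈Q → P⊆Q _ (*∈ c (Q⊆P _ v∈Q))
    }
    where open IsSubspace P-sub

  ｛0｝ : ∀ ℓ → Pred Carrierᴹ (ℓm ⊔ ℓ)
  ｛0｝ ℓ v = Lift ℓ (v ≈ᴹ 0ᴹ)

  infixl 6 _+ᴾ_
  _+ᴾ_ : ∀ {ℓ ℓ'} → Pred Carrierᴹ ℓ → Pred Carrierᴹ ℓ' → Pred Carrierᴹ (m ⊔ ℓm ⊔ ℓ ⊔ ℓ')
  (P +ᴾ Q) v = ∃ λ x → ∃ λ y → P x × Q y × v ≈ᴹ x +ᴹ y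

  module _ {ℓ ℓ'} {P : Pred Carrierᴹ ℓ} {Q : Pred Carrierᴹ ℓ'} (P-sub : IsSubspace P) (Q-sub : IsSubspace Q) where
    private
      module P = IsSubspace P-sub
      module Q = IsSubspace Q-sub

    +ᴾ-isSubspace : IsSubspace (P +ᴾ Q)
    +ᴾ-isSubspace = record
      { resp  = λ { u≈v (x , y , x∈P , y∈Q , u≈) → x , y , x∈P , y∈Q , ≈ᴹ-trans (≈ᴹ-sym u≈v) u≈ }
      ; zero∈ = 0ᴹ , 0ᴹ , P.zero∈ , Q.zero∈ , ≈ᴹ-sym (+ᴹ-identityˡ 0ᴹ)
      ; +∈    = λ { (x , y , x∈P , y∈Q , u≈) (x' , y' , x'∈P , y'∈Q , v≈) →
                    x +ᴹ x' , y +ᴹ y' , P.+∈ x∈P x'∈P , Q.+∈ y∈Q y'∈Q ,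
                    ≈ᴹ-trans (+ᴹ-cong u≈ v≈) (interchange x y x' y') }
      ; *∈    = λ { c (x , y , x∈P , y∈Q , v≈) →
                    c *ₗ x , c *ₗ y , P.*∈ c x∈P , Q.*∈ c y∈Q , ≈ᴹ-trans (*ₗ-congˡ v≈) (*ₗ-distribˡ c x y) }
      }

    ∩-isSubspace : IsSubspace (P ∩ Q)
    ∩-isSubspace = record
      { resp  = λ { u≈v (u∈P , u∈Q) → P.resp u≈v u∈P , Q.resp u≈v u∈Q }
      ; zero∈ = P.zero∈ , Q.zero∈
      ; +∈    = λ { (u∈P , u∈Q) (v∈P , v∈Q) → P.+∈ u∈P v∈P , Q.+∈ u∈Q v∈Q }
      ; *∈    = λ { c (v∈P , v∈Q) → P.*∈ c v∈P , Q.*∈ c v∈Q }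
      }

  ｛0｝-isSubspace : ∀ ℓ → IsSubspace (｛0｝ ℓ)
  ｛0｝-isSubspace ℓ = record
    { resp  = λ { u≈v (lift u≈0) → lift (≈ᴹ-trans (≈ᴹ-sym u≈v) u≈0) }
    ; zero∈ = lift ≈ᴹ-refl
    ; +∈    = λ { (lift u≈0) (lift v≈0) → lift (≈ᴹ-trans (+ᴹ-cong u≈0 v≈0) (+ᴹ-identityˡ 0ᴹ)) }
    ; *∈    = λ { c (lift v≈0) → lift (y≈0⇒x*y≈0 v≈0) }
    }

  ｛0｝-least : ∀ {ℓ ℓ'} {T : Pred Carrierᴹ ℓ'} → IsSubspace T → ∀ v → ｛0｝ ℓ v → T v
  ｛0｝-least T-sub v (lift v≈0) = IsSubspace.resp T-sub (≈ᴹ-sym v≈0) (IsSubspace.zero∈ T-sub)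

  +ᴾ-upperˡ : ∀ {ℓ ℓ'} {P : Pred Carrierᴹ ℓ} {Q : Pred Carrierᴹ ℓ'} → IsSubspace Q → ∀ {v} → P v → (P +ᴾ Q) v
  +ᴾ-upperˡ Q-sub {v} v∈P = v , 0ᴹ , v∈P , IsSubspace.zero∈ Q-sub , ≈ᴹ-sym (+ᴹ-identityʳ v)

  +ᴾ-upperʳ : ∀ {ℓ ℓ'} {P : Pred Carrierᴹ ℓ} {Q : Pred Carrierᴹ ℓ'} → IsSubspace P → ∀ {v} → Q v → (P +ᴾ Q) v
  +ᴾ-upperʳ P-sub {v} v∈Q = 0ᴹ , v , IsSubspace.zero∈ P-sub , v∈Q , ≈ᴹ-sym (+ᴹ-identityˡ v)

  +ᴾ-least : ∀ {ℓ ℓ' ℓ''} {P : Pred Carrierᴹ ℓ} {Q : Pred Carrierᴹ ℓ'} {T : Pred Carrierᴹ ℓ''} → IsSubspace T →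
    (∀ v → P v → T v) → (∀ v → Q v → T v) → ∀ v → (P +ᴾ Q) v → T v
  +ᴾ-least T-sub P⊆T Q⊆T v (x , y , x∈P , y∈Q , v≈) =
    IsSubspace.resp T-sub (≈ᴹ-sym v≈) (IsSubspace.+∈ T-sub (P⊆T x x∈P) (Q⊆T y y∈Q))

  ∩-dim-equal⇒SameSet : ∀ {ℓ} {P Q : Pred Carrierᴹ ℓ} {d} → IsSubspace P → IsSubspace Q →
    HasDim P d → HasDim Q d → HasDim (P ∩ Q) d → ¬ ¬ SameSet P Q
  ∩-dim-equal⇒SameSet P-sub Q-sub dimP dimQ dimP∩Q = do
    P⊆P∩Q ← dim-equal⇒⊇ P∩Q-sub (λ _ → proj₁) (HasDim⇒HasDim¬¬ dimP∩Q) dimP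
    Q⊆P∩Q ← dim-equal⇒⊇ P∩Q-sub (λ _ → proj₂) (HasDim⇒HasDim¬¬ dimP∩Q) dimQ
    pure ((λ v → proj₂ ∘ P⊆P∩Q v) , (λ v → proj₁ ∘ Q⊆P∩Q v))
    where P∩Q-sub = ∩-isSubspace P-sub Q-sub

  ⨁ : ∀ {ℓ} → ℕ → (ℕ → Pred Carrierᴹ ℓ) → Pred Carrierᴹ (m ⊔ ℓm ⊔ ℓ)
  ⨁ {ℓ} zero    f = ｛0｝ (m ⊔ ℓ)
  ⨁     (suc M) f = ⨁ M f +ᴾ f M

  module _ {ℓ} {f : ℕ → Pred Carrierᴹ ℓ} where

    ⨁-isSubspace : ∀ {M} → (∀ {a} → a < M → IsSubspace (f a)) → IsSubspace (⨁ M f)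
    ⨁-isSubspace {zero}  f-sub = ｛0｝-isSubspace _
    ⨁-isSubspace {suc M} f-sub = +ᴾ-isSubspace (⨁-isSubspace (f-sub ∘ ℕₚ.m<n⇒m<1+n)) (f-sub ℕₚ.≤-refl)

    ⨁-least : ∀ {M ℓ'} {T : Pred Carrierᴹ ℓ'} → IsSubspace T →
      (∀ {a} → a < M → ∀ v → f a v → T v) → ∀ v → ⨁ M f v → T v
    ⨁-least {zero}  T-sub f⊆T = ｛0｝-least T-sub
    ⨁-least {suc M} T-sub f⊆T = +ᴾ-least T-sub (⨁-least T-sub (f⊆T ∘ ℕₚ.m<n⇒m<1+n)) (f⊆T ℕₚ.≤-refl)

    ⨁-upper : ∀ {M} → (∀ {a} → a < M → IsSubspace (f a)) → ∀ {a} → a < M → ∀ {v} → f a v → ⨁ M f v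
    ⨁-upper {suc M} f-sub {a} (s≤s a≤M) with ℕₚ.m≤n⇒m<n∨m≡n a≤M
    ... | inj₁ a<M    = +ᴾ-upperˡ (f-sub ℕₚ.≤-refl) ∘ ⨁-upper (f-sub ∘ ℕₚ.m<n⇒m<1+n) a<M
    ... | inj₂ ≡.refl = +ᴾ-upperʳ (⨁-isSubspace (f-sub ∘ ℕₚ.m<n⇒m<1+n))

  module _ {ℓ} (Q : Pred Carrierᴹ ℓ) where
    private
      scale : K → K × Carrierᴹ → K × Carrierᴹ
      scale x cv = x * proj₁ cv , proj₂ cv

      lincombL-++ : ∀ xs ys → lincombL (xs List.++ ys) ≈ᴹ lincombL xs +ᴹ lincombL ys
      lincombL-++ []       ys = ≈ᴹ-sym (+ᴹ-identityˡ _)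
      lincombL-++ (_ ∷ᴸ xs) ys = ≈ᴹ-trans (+ᴹ-congˡ (lincombL-++ xs ys)) (≈ᴹ-sym (+ᴹ-assoc _ _ _))

      lincombL-scale : ∀ x xs → lincombL (List.map (scale x) xs) ≈ᴹ x *ₗ lincombL xs
      lincombL-scale x []              = ≈ᴹ-sym (*ₗ-zeroʳ x)
      lincombL-scale x ((c , v) ∷ᴸ xs) =
        ≈ᴹ-trans (+ᴹ-cong (*ₗ-assoc x c v) (lincombL-scale x xs)) (≈ᴹ-sym (*ₗ-distribˡ x _ _))

    Span-isSubspace : IsSubspace (Span Q)
    Span-isSubspace = record
      { resp  = λ { u≈v (xs , xs∈Q , u≈) → xs , xs∈Q , ≈ᴹ-trans (≈ᴹ-sym u≈v) u≈ }
      ; zero∈ = [] , [] , ≈ᴹ-refl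
      ; +∈    = λ { (xs , xs∈Q , u≈) (ys , ys∈Q , v≈) →
                    xs List.++ ys , All.++⁺ xs∈Q ys∈Q , ≈ᴹ-trans (+ᴹ-cong u≈ v≈) (≈ᴹ-sym (lincombL-++ xs ys)) }
      ; *∈    = λ { c (xs , xs∈Q , v≈) →
                    List.map (scale c) xs , All.map⁺ xs∈Q , ≈ᴹ-trans (*ₗ-congˡ v≈) (≈ᴹ-sym (lincombL-scale c xs)) }
      }

    Span-upper : ∀ {v} → Q v → Span Q v
    Span-upper {v} v∈Q = (1# , v) ∷ᴸ [] , v∈Q All.∷ [] , ≈ᴹ-sym (≈ᴹ-trans (+ᴹ-identityʳ _) (*ₗ-identityˡ v))

    Span-least¬¬ : ∀ {ℓ'} {T : Pred Carrierᴹ ℓ'} → IsSubspace T → (∀ v → Q v → ¬ ¬ T v) → ∀ v → Span Q v → ¬ ¬ T v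
    Span-least¬¬ {T = T} T-sub Q⊆T v (xs , xs∈Q , v≈) = do
      xs∈T ← lincombL-∈ xs xs∈Q
      pure (IsSubspace.resp T-sub (≈ᴹ-sym v≈) xs∈T)
      where
      lincombL-∈ : ∀ xs → All (Q ∘ proj₂) xs → ¬ ¬ T (lincombL xs)
      lincombL-∈ []              []              = pure (IsSubspace.zero∈ T-sub)
      lincombL-∈ ((c , x) ∷ᴸ xs) (x∈Q All.∷ xs∈Q) = do
        x∈T  ← Q⊆T x x∈Q
        xs∈T ← lincombL-∈ xs xs∈Q
        pure (IsSubspace.+∈ T-sub (IsSubspace.*∈ T-sub c x∈T) xs∈T)

module Grassmann {r ℓr m ℓm} {F : CommutativeRing r ℓr} (isField : IsField F) (V : Module F m ℓm) where

  open CommutativeRing F renaming (Carrier to K) using (_≈_; 0#; -_)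
  open Module V
  open LinearAlgebra isField V
  open GroupProperties +ᴹ-group using (\\-leftDividesˡ; \\-leftDividesʳ; //-rightDividesʳ)
  open SetoidReasoning ≈ᴹ-setoid

  module ² = LinearAlgebra isField (⟨module⟩ V V)

  V² : Set m
  V² = Carrierᴹ × Carrierᴹ

  private
    lincomb-proj : ∀ {d} (c : Fin d → K) (f : Fin d → V²) →
      proj₁ (².lincomb c f) ≈ᴹ lincomb c (proj₁ ∘ f) × proj₂ (².lincomb c f) ≈ᴹ lincomb c (proj₂ ∘ f)
    lincomb-proj {zero}  c f = ≈ᴹ-refl , ≈ᴹ-refl
    lincomb-proj {suc d} c f = +ᴹ-congˡ (proj₁ rest) , +ᴹ-congˡ (proj₂ rest)
      where rest = lincomb-proj (tail c) (tail f)

    ∈⟨++⟩² : ∀ {p q} {F₁ : Fin p → V²} {F₂ : Fin q → V²} c c' {x y} →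
      x ≈ᴹ lincomb c (proj₁ ∘ F₁) +ᴹ lincomb c' (proj₁ ∘ F₂) →
      y ≈ᴹ lincomb c (proj₂ ∘ F₁) +ᴹ lincomb c' (proj₂ ∘ F₂) → (x , y) ².∈⟨ F₁ ++ F₂ ⟩
    ∈⟨++⟩² {F₁ = F₁} {F₂} c c' x≈ y≈ = ².∈⟨++⟩ c c'
      ( ≈ᴹ-trans x≈ (≈ᴹ-sym (+ᴹ-cong (proj₁ (lincomb-proj c F₁)) (proj₁ (lincomb-proj c' F₂))))
      , ≈ᴹ-trans y≈ (≈ᴹ-sym (+ᴹ-cong (proj₂ (lincomb-proj c F₁)) (proj₂ (lincomb-proj c' F₂)))))

    LinIndep¬¬-++² : ∀ {p q} {F₁ : Fin p → V²} {F₂ : Fin q → V²} →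
      (∀ c c' → lincomb c (proj₁ ∘ F₁) +ᴹ lincomb c' (proj₁ ∘ F₂) ≈ᴹ 0ᴹ →
                lincomb c (proj₂ ∘ F₁) +ᴹ lincomb c' (proj₂ ∘ F₂) ≈ᴹ 0ᴹ →
                (∀ i → ¬ ¬ (c i ≈ 0#)) × (∀ j → ¬ ¬ (c' j ≈ 0#))) →
      ².LinIndep¬¬ (F₁ ++ F₂)
    LinIndep¬¬-++² {F₁ = F₁} {F₂} halves = ².LinIndep¬¬-++ λ c c' (≈0₁ , ≈0₂) → halves c c'
      (≈ᴹ-trans (≈ᴹ-sym (+ᴹ-cong (proj₁ (lincomb-proj c F₁)) (proj₁ (lincomb-proj c' F₂)))) ≈0₁)
      (≈ᴹ-trans (≈ᴹ-sym (+ᴹ-cong (proj₂ (lincomb-proj c F₁)) (proj₂ (lincomb-proj c' F₂)))) ≈0₂)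

    +-zero-family : ∀ {p q} (c : Fin p → K) (u : Fin p → Carrierᴹ) (c' : Fin q → K) →
      lincomb c u +ᴹ lincomb c' (λ _ → 0ᴹ) ≈ᴹ lincomb c u
    +-zero-family c u c' = ≈ᴹ-trans (+ᴹ-congˡ (lincomb-zeroʳ c' (λ _ → ≈ᴹ-refl))) (+ᴹ-identityʳ _)

    zero-family-+ : ∀ {p q} (c : Fin p → K) (c' : Fin q → K) (w : Fin q → Carrierᴹ) →
      lincomb c (λ _ → 0ᴹ) +ᴹ lincomb c' w ≈ᴹ lincomb c' w
    zero-family-+ c c' w = ≈ᴹ-trans (+ᴹ-congʳ (lincomb-zeroʳ c (λ _ → ≈ᴹ-refl))) (+ᴹ-identityˡ _)

  module _ {ℓ ℓ'} {P : Pred Carrierᴹ ℓ} {Q : Pred Carrierᴹ ℓ'} {δ} (dimP+Q : HasDim¬¬ (P +ᴾ Q) δ) where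
    private
      bS = proj₁ dimP+Q
      bS-split : ∀ l → (P +ᴾ Q) (bS l)
      bS-split = proj₁ (proj₂ dimP+Q)
      x y : Fin δ → Carrierᴹ
      x l = proj₁ (bS-split l)
      y l = proj₁ (proj₂ (bS-split l))
      x∈P : ∀ l → P (x l)
      x∈P l = proj₁ (proj₂ (proj₂ (bS-split l)))
      y∈Q : ∀ l → Q (y l)
      y∈Q l = proj₁ (proj₂ (proj₂ (proj₂ (bS-split l))))
      bS≈x+y : ∀ l → bS l ≈ᴹ x l +ᴹ y l
      bS≈x+y l = proj₂ (proj₂ (proj₂ (proj₂ (bS-split l))))

    -- In V × V, the independent vectors (s , x), for s = x + y in a basis of P + Q, and (0 , c), for c
    -- in a basis of P ∩ Q, lie in the span of the vectors (p , p) and (q , 0), p and q in bases of P and Q.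
    grassmann-≤ : ∀ {α β γ} → HasDim¬¬ P α → HasDim¬¬ Q β → HasDim¬¬ (P ∩ Q) γ → ¬ ¬ (δ ℕ.+ γ ≤ α ℕ.+ β)
    grassmann-≤ (bP , _ , _ , P⊆⟨bP⟩) (bQ , _ , _ , Q⊆⟨bQ⟩) (bC , bC∈P∩Q , indepC , _) =
      ².independent≤spanning (G₁ ++ G₂) (LinIndep¬¬-++² independent)
        (++-All {P = λ f → ¬ ¬ (f ².∈⟨ G₁ ++ G₂ ⟩)} F₁-spanned F₂-spanned)
      where
      F₁ = λ l → bS l , x l
      F₂ = λ k → 0ᴹ , bC k
      G₁ = λ i → bP i , bP i
      G₂ = λ j → bQ j , 0ᴹ

      independent : ∀ c c' → lincomb c bS +ᴹ lincomb c' (λ _ → 0ᴹ) ≈ᴹ 0ᴹ → lincomb c x +ᴹ lincomb c' bC ≈ᴹ 0ᴹ →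
        (∀ l → ¬ ¬ (c l ≈ 0#)) × (∀ k → ¬ ¬ (c' k ≈ 0#))
      independent c c' ≈0₁ ≈0₂ = c≈0 , c'≈0
        where
        c≈0 = proj₁ (proj₂ (proj₂ dimP+Q)) c (≈ᴹ-trans (≈ᴹ-sym (+-zero-family c bS c')) ≈0₁)
        c'≈0 : ∀ k → ¬ ¬ (c' k ≈ 0#)
        c'≈0 k = do
          all-c≈0 ← ¬¬-Π-Fin c≈0
          indepC c' (≈ᴹ-trans (≈ᴹ-sym (≈ᴹ-trans (+ᴹ-congʳ (lincomb-zeroˡ x all-c≈0)) (+ᴹ-identityˡ _))) ≈0₂) k

      F₁-spanned : ∀ l → ¬ ¬ (F₁ l ².∈⟨ G₁ ++ G₂ ⟩)
      F₁-spanned l = do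
        (c₁ , x≈) ← P⊆⟨bP⟩ _ (x∈P l)
        (c₂ , y≈) ← Q⊆⟨bQ⟩ _ (y∈Q l)
        pure (∈⟨++⟩² c₁ c₂ (≈ᴹ-trans (bS≈x+y l) (+ᴹ-cong x≈ y≈)) (≈ᴹ-trans x≈ (≈ᴹ-sym (+-zero-family c₁ bP c₂))))

      F₂-spanned : ∀ k → ¬ ¬ (F₂ k ².∈⟨ G₁ ++ G₂ ⟩)
      F₂-spanned k = do
        (c₁ , ≈₁) ← P⊆⟨bP⟩ _ (proj₁ (bC∈P∩Q k))
        (c₂ , ≈₂) ← Q⊆⟨bQ⟩ _ (proj₂ (bC∈P∩Q k))
        pure (∈⟨++⟩² c₁ (λ j → - c₂ j)
          (≈ᴹ-sym (begin
            lincomb c₁ bP +ᴹ lincomb (λ j → - c₂ j) bQ ≈⟨ +ᴹ-cong (≈ᴹ-sym ≈₁) (lincomb-negˡ c₂ bQ) ⟩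
            bC k +ᴹ -ᴹ lincomb c₂ bQ                   ≈⟨ +ᴹ-congˡ (-ᴹ‿cong ≈₂) ⟨
            bC k +ᴹ -ᴹ bC k                            ≈⟨ -ᴹ‿inverseʳ (bC k) ⟩
            0ᴹ                                         ∎))
          (≈ᴹ-trans ≈₁ (≈ᴹ-sym (+-zero-family c₁ bP (λ j → - c₂ j)))))

    -- Dually, the independent vectors (p , 0) and (0 , q) lie in the span of the (x , y) and the (c , - c).
    grassmann-≥ : ∀ {α β γ} → IsSubspace P → IsSubspace Q →
      HasDim¬¬ P α → HasDim¬¬ Q β → HasDim¬¬ (P ∩ Q) γ → ¬ ¬ (α ℕ.+ β ≤ δ ℕ.+ γ)
    grassmann-≥ P-sub Q-sub (bP , bP∈P , indepP , _) (bQ , bQ∈Q , indepQ , _) (bC , _ , _ , C⊆⟨bC⟩) =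
      ².independent≤spanning (G₁ ++ G₂) (LinIndep¬¬-++² independent)
        (++-All {P = λ f → ¬ ¬ (f ².∈⟨ G₁ ++ G₂ ⟩)}
          (λ i → pair-spanned (bP∈P i) (IsSubspace.zero∈ Q-sub))
          (λ j → pair-spanned (IsSubspace.zero∈ P-sub) (bQ∈Q j)))
      where
      F₁ = λ i → bP i , 0ᴹ
      F₂ = λ j → 0ᴹ , bQ j
      G₁ = λ l → x l , y l
      G₂ = λ k → bC k , -ᴹ bC k

      independent : ∀ c c' → lincomb c bP +ᴹ lincomb c' (λ _ → 0ᴹ) ≈ᴹ 0ᴹ →
        lincomb c (λ _ → 0ᴹ) +ᴹ lincomb c' bQ ≈ᴹ 0ᴹ →
        (∀ i → ¬ ¬ (c i ≈ 0#)) × (∀ j → ¬ ¬ (c' j ≈ 0#))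
      independent c c' ≈0₁ ≈0₂ =
        indepP c (≈ᴹ-trans (≈ᴹ-sym (+-zero-family c bP c')) ≈0₁) ,
        indepQ c' (≈ᴹ-trans (≈ᴹ-sym (zero-family-+ c c' bQ)) ≈0₂)

      -- Write p + q = X + Y with X ∈ P, Y ∈ Q; then z = p - X = Y - q lies in P ∩ Q.
      pair-spanned : ∀ {p q} → P p → Q q → ¬ ¬ ((p , q) ².∈⟨ G₁ ++ G₂ ⟩)
      pair-spanned {p} {q} p∈P q∈Q = do
        (λs , p+q≈) ← proj₂ (proj₂ (proj₂ dimP+Q)) (p +ᴹ q) (p , q , p∈P , q∈Q , ≈ᴹ-refl)
        let X = lincomb λs x
            Y = lincomb λs y
            z = -ᴹ X +ᴹ p
            z+q≈Y : z +ᴹ q ≈ᴹ Y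
            z+q≈Y = begin
              (-ᴹ X +ᴹ p) +ᴹ q      ≈⟨ +ᴹ-assoc _ p q ⟩
              -ᴹ X +ᴹ (p +ᴹ q)      ≈⟨ +ᴹ-congˡ p+q≈ ⟩
              -ᴹ X +ᴹ lincomb λs bS ≈⟨ +ᴹ-congˡ (lincomb-cong (λ _ → CommutativeRing.refl F) bS≈x+y) ⟩
              -ᴹ X +ᴹ lincomb λs (λ l → x l +ᴹ y l) ≈⟨ +ᴹ-congˡ (lincomb-+ʳ λs x y) ⟩
              -ᴹ X +ᴹ (X +ᴹ Y)      ≈⟨ \\-leftDividesʳ X Y ⟩
              Y                     ∎
            z∈P = IsSubspace.+∈ P-sub (-ᴹ-∈ P-sub (lincomb-∈ P-sub λs x∈P)) p∈P
            z∈Q = IsSubspace.resp Q-sub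
              (≈ᴹ-trans (+ᴹ-congʳ (≈ᴹ-sym z+q≈Y)) (//-rightDividesʳ q z))
              (IsSubspace.+∈ Q-sub (lincomb-∈ Q-sub λs y∈Q) (-ᴹ-∈ Q-sub q∈Q))
        (μ , z≈) ← C⊆⟨bC⟩ z (z∈P , z∈Q)
        pure (∈⟨++⟩² λs μ
          (≈ᴹ-trans (≈ᴹ-sym (\\-leftDividesˡ X p)) (+ᴹ-congˡ z≈))
          (begin
            q                             ≈⟨ \\-leftDividesʳ z q ⟨
            -ᴹ z +ᴹ (z +ᴹ q)              ≈⟨ +ᴹ-congˡ z+q≈Y ⟩
            -ᴹ z +ᴹ Y                     ≈⟨ +ᴹ-comm _ Y ⟩
            Y +ᴹ -ᴹ z                     ≈⟨ +ᴹ-congˡ (-ᴹ‿cong z≈) ⟩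
            Y +ᴹ -ᴹ lincomb μ bC          ≈⟨ +ᴹ-congˡ (lincomb-negʳ μ bC) ⟨
            Y +ᴹ lincomb μ (λ k → -ᴹ bC k) ∎))

open import Data.Nat using (_+_; _*_; _∸_)

module Arithmetic where

  open ℕₚ using (+-mono-≤; +-monoˡ-≤; +-monoʳ-≤; +-cancelʳ-≤; ≤-trans; ≤-pred; ≤-reflexive; +-suc; +-identityʳ)
  open ℕₚ.≤-Reasoning
  open import Data.Nat.Tactic.RingSolver using (solve-∀)

  bound : ℕ → ℕ → ℕ → ℕ
  bound k t j = 2 * k + 2 * j * t

  growth-bound : ∀ {s s' i i' k j σ ρ x} → s' + σ ≤ s + k → i' + ρ ≤ i + j → j ≤ σ → x ≤ ρ → s' + i' + x ≤ s + i + k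
  growth-bound {s} {s'} {i} {i'} {k} {j} {σ} {ρ} {x} S' I' j≤σ x≤ρ = +-cancelʳ-≤ σ _ _ (begin
    s' + i' + x + σ   ≤⟨ +-monoˡ-≤ σ (+-monoʳ-≤ (s' + i') x≤ρ) ⟩
    s' + i' + ρ + σ   ≡⟨ e₁ s' i' ρ σ ⟩
    (s' + σ) + (i' + ρ) ≤⟨ +-mono-≤ S' I' ⟩
    (s + k) + (i + j) ≤⟨ +-monoʳ-≤ (s + k) (+-monoʳ-≤ i j≤σ) ⟩
    (s + k) + (i + σ) ≡⟨ e₂ s k i σ ⟩
    s + i + k + σ     ∎)
    where
    e₁ : ∀ a b c d → a + b + c + d ≡ (a + d) + (b + c)
    e₁ = solve-∀
    e₂ : ∀ a b c d → (a + b) + (c + d) ≡ a + c + b + d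
    e₂ = solve-∀

  base-step : ∀ {s i δ c k} t → s ≤ δ → i ≤ c → δ + c ≤ k + k → s + i + 0 ≤ bound k t 0
  base-step {s} {i} {δ} {c} {k} t s≤δ i≤c δ+c≤2k = begin
    s + i + 0 ≡⟨ +-identityʳ (s + i) ⟩
    s + i     ≤⟨ +-mono-≤ s≤δ i≤c ⟩
    δ + c     ≤⟨ δ+c≤2k ⟩
    k + k     ≡⟨ e k t ⟩
    bound k t 0 ∎
    where
    e : ∀ k t → k + k ≡ 2 * k + 2 * 0 * t
    e = solve-∀

  sunflower-step : ∀ {s s' i i' c t j} → s' + i' + c ≤ s + i + (c + t) → s + i + j ≤ bound (c + t) t j → 1 ≤ t →
    s' + i' + suc j ≤ bound (c + t) t (suc j)
  sunflower-step {s} {s'} {i} {i'} {c} {t} {j} grows IH 1≤t = +-cancelʳ-≤ c _ _ (begin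
    s' + i' + suc j + c         ≡⟨ e₁ s' i' j c ⟩
    (s' + i' + c) + suc j       ≤⟨ +-monoˡ-≤ (suc j) grows ⟩
    s + i + (c + t) + suc j     ≡⟨ e₂ s i c t j ⟩
    (s + i + j) + (c + t + 1)   ≤⟨ +-mono-≤ IH (+-monoʳ-≤ (c + t) 1≤t) ⟩
    bound (c + t) t j + (c + t + t) ≡⟨ e₃ c t j ⟩
    bound (c + t) t (suc j) + c ∎)
    where
    e₁ : ∀ a b j c → a + b + suc j + c ≡ (a + b + c) + suc j
    e₁ = solve-∀
    e₂ : ∀ s i c t j → s + i + (c + t) + suc j ≡ (s + i + j) + (c + t + 1)
    e₂ = solve-∀
    e₃ : ∀ c t j → 2 * (c + t) + 2 * j * t + (c + t + t) ≡ 2 * (c + t) + 2 * suc j * t + c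
    e₃ = solve-∀

  general-step : ∀ {s s' i i' c t j x y δ e} → s' + i' + x ≤ s + i + (c + t) → c + y ≤ δ + x → δ ≤ c + t →
    e + c ≤ y → s + i + j ≤ e + bound (c + t) t j → s' + i' + suc j ≤ 1 + bound (c + t) t (suc j)
  general-step {s} {s'} {i} {i'} {c} {t} {j} {x} {y} {δ} {e} grows grassmann δ≤k e+c≤y IH =
    +-cancelʳ-≤ (c + (e + c)) _ _ (begin
      L + (c + (e + c))               ≤⟨ +-monoʳ-≤ L (+-monoʳ-≤ c e+c≤y) ⟩
      L + (c + y)                     ≤⟨ +-monoʳ-≤ L grassmann ⟩
      L + (δ + x)                     ≤⟨ +-monoʳ-≤ L (+-monoˡ-≤ x δ≤k) ⟩
      L + (c + t + x)                 ≡⟨ e₁ s' i' x j c t ⟩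
      (s' + i' + x) + (suc j + c + t) ≤⟨ +-monoˡ-≤ _ grows ⟩
      (s + i + (c + t)) + (suc j + c + t) ≡⟨ e₂ s i j c t ⟩
      (s + i + j) + (2 * (c + t) + 1) ≤⟨ +-monoˡ-≤ _ IH ⟩
      e + bound (c + t) t j + (2 * (c + t) + 1) ≡⟨ e₃ c t j e ⟩
      1 + bound (c + t) t (suc j) + (c + (e + c)) ∎)
    where
    L = s' + i' + suc j
    e₁ : ∀ s' i' x j c t → s' + i' + suc j + (c + t + x) ≡ (s' + i' + x) + (suc j + c + t)
    e₁ = solve-∀
    e₂ : ∀ s i j c t → (s + i + (c + t)) + (suc j + c + t) ≡ (s + i + j) + (2 * (c + t) + 1)
    e₂ = solve-∀
    e₃ : ∀ c t j e →
      e + (2 * (c + t) + 2 * j * t) + (2 * (c + t) + 1) ≡ 1 + (2 * (c + t) + 2 * suc j * t) + (c + (e + c))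
    e₃ = solve-∀

  drop-suc : ∀ {a b c} → a + suc b ≤ suc c → a + b ≤ c
  drop-suc {a} {b} a+1+b≤1+c = ≤-pred (≤-trans (≤-reflexive (≡.sym (+-suc a b))) a+1+b≤1+c)

module SCID {r ℓr m ℓm ℓ} {F : CommutativeRing r ℓr} (isField : IsField F) (V : Module F m ℓm)
  {n : ℕ} (π : Fin n → Pred (Module.Carrierᴹ V) ℓ) (π-sub : ∀ i → VectorSpace.IsSubspace V (π i))
  (c t : ℕ) (π-dim : ∀ i → VectorSpace.HasDim V (π i) (c + t))
  (π-∩-dim : ∀ i j → i ≢ j → VectorSpace.HasDim V (π i ∩ π j) c)
  {dS : ℕ} (S-dim : VectorSpace.HasDim V (VectorSpace.Span V (λ v → ∃ λ i → π i v)) dS)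
  where

  open Module V using (Carrierᴹ)
  open LinearAlgebra isField V
  open Grassmann isField V
  open Arithmetic

  k : ℕ
  k = c + t

  ⋃π : Pred Carrierᴹ ℓ
  ⋃π v = ∃ λ i → π i v

  S : Pred Carrierᴹ (r ⊔ m ⊔ ℓm ⊔ ℓ)
  S = Span ⋃π

  -- π̂ a is π a for a < n and empty for a ≥ n.
  π̂ : ℕ → Pred Carrierᴹ ℓ
  π̂ a v = ∃ λ i → toℕ i ≡ a × π i v

  π̂≡π : ∀ {a} (a<n : a < n) → SameSet (π (fromℕ< a<n)) (π̂ a)
  π̂≡π a<n = (λ v v∈π → fromℕ< a<n , toℕ-fromℕ< a<n , v∈π)
          , (λ { v (i , ≡.refl , v∈π) → ≡.subst (λ j → π j v) (≡.sym (fromℕ<-toℕ i a<n)) v∈π })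

  π̂-sub : ∀ {a} → a < n → IsSubspace (π̂ a)
  π̂-sub a<n = IsSubspace-resp (π̂≡π a<n) (π-sub _)

  π̂-dim : ∀ {a} → a < n → HasDim¬¬ (π̂ a) k
  π̂-dim a<n = HasDim¬¬-resp (π̂≡π a<n) (HasDim⇒HasDim¬¬ (π-dim _))

  π̂-∩-dim : ∀ {a b} → a < n → b < n → a ≢ b → HasDim¬¬ (π̂ a ∩ π̂ b) c
  π̂-∩-dim a<n b<n a≢b = HasDim¬¬-resp
    ( (λ v (v∈πa , v∈πb) → proj₁ (π̂≡π a<n) v v∈πa , proj₁ (π̂≡π b<n) v v∈πb)
    , (λ v (v∈π̂a , v∈π̂b) → proj₂ (π̂≡π a<n) v v∈π̂a , proj₂ (π̂≡π b<n) v v∈π̂b))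
    (HasDim⇒HasDim¬¬ (π-∩-dim _ _ (a≢b ∘ fromℕ<-injective _ _ a<n b<n)))

  𝒮 𝒥 ℐ : ℕ → Pred Carrierᴹ (m ⊔ ℓm ⊔ ℓ)
  𝒮 M = ⨁ M π̂
  𝒥 a = ⨁ a (λ b → π̂ a ∩ π̂ b)
  ℐ M = ⨁ M 𝒥

  𝒮-sub : ∀ {M} → M ≤ n → IsSubspace (𝒮 M)
  𝒮-sub M≤n = ⨁-isSubspace (λ a<M → π̂-sub (ℕₚ.<-≤-trans a<M M≤n))

  π̂∩π̂-sub : ∀ {a b} → a < n → b < n → IsSubspace (π̂ a ∩ π̂ b)
  π̂∩π̂-sub a<n b<n = ∩-isSubspace (π̂-sub a<n) (π̂-sub b<n)

  𝒥-sub : ∀ {a} → a < n → IsSubspace (𝒥 a)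
  𝒥-sub a<n = ⨁-isSubspace (λ b<a → π̂∩π̂-sub a<n (ℕₚ.<-trans b<a a<n))

  ℐ-sub : ∀ {M} → M ≤ n → IsSubspace (ℐ M)
  ℐ-sub M≤n = ⨁-isSubspace (λ a<M → 𝒥-sub (ℕₚ.<-≤-trans a<M M≤n))

  ℐ-least : ∀ {M ℓ'} {T : Pred Carrierᴹ ℓ'} → IsSubspace T →
    (∀ {a b} → b < a → a < M → ∀ v → (π̂ a ∩ π̂ b) v → T v) → ∀ v → ℐ M v → T v
  ℐ-least T-sub ∩⊆T = ⨁-least T-sub (λ a<M → ⨁-least T-sub (λ b<a → ∩⊆T b<a a<M))

  π̂⊆𝒮 : ∀ {a M} → a < M → M ≤ n → ∀ {v} → π̂ a v → 𝒮 M v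
  π̂⊆𝒮 a<M M≤n = ⨁-upper (λ a<M → π̂-sub (ℕₚ.<-≤-trans a<M M≤n)) a<M

  ∩⊆𝒥 : ∀ {a b} → b < a → a < n → ∀ {v} → (π̂ a ∩ π̂ b) v → 𝒥 a v
  ∩⊆𝒥 b<a a<n = ⨁-upper (λ b<a → π̂∩π̂-sub a<n (ℕₚ.<-trans b<a a<n)) b<a

  𝒥⊆ℐ : ∀ {a M} → a < M → M ≤ n → ∀ {v} → 𝒥 a v → ℐ M v
  𝒥⊆ℐ a<M M≤n = ⨁-upper (λ a<M → 𝒥-sub (ℕₚ.<-≤-trans a<M M≤n)) a<M

  ∩⊆ℐ : ∀ {a b M} → a < M → b < M → a ≢ b → M ≤ n → ∀ {v} → (π̂ a ∩ π̂ b) v → ℐ M v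
  ∩⊆ℐ {a} {b} a<M b<M a≢b M≤n with ℕₚ.<-cmp a b
  ... | tri< a<b _ _ = λ (v∈π̂a , v∈π̂b) → 𝒥⊆ℐ b<M M≤n (∩⊆𝒥 a<b (ℕₚ.<-≤-trans b<M M≤n) (v∈π̂b , v∈π̂a))
  ... | tri≈ _ a≡b _ = ⊥-elim (a≢b a≡b)
  ... | tri> _ _ b<a = 𝒥⊆ℐ a<M M≤n ∘ ∩⊆𝒥 b<a (ℕₚ.<-≤-trans a<M M≤n)

  𝒥⊆𝒮∩π̂ : ∀ {M} → M < n → ∀ v → 𝒥 M v → (𝒮 M ∩ π̂ M) v
  𝒥⊆𝒮∩π̂ {M} M<n = ⨁-least {f = λ b → π̂ M ∩ π̂ b} (∩-isSubspace (𝒮-sub (ℕₚ.<⇒≤ M<n)) (π̂-sub M<n))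
    (λ b<M v (v∈π̂M , v∈π̂b) → π̂⊆𝒮 b<M (ℕₚ.<⇒≤ M<n) v∈π̂b , v∈π̂M)

  π̂⊆S : ∀ a v → π̂ a v → S v
  π̂⊆S a v (i , _ , v∈πi) = Span-upper ⋃π (i , v∈πi)

  dim¬¬ : ∀ {ℓ'} (P : Pred Carrierᴹ ℓ') → (∀ v → P v → S v) → ¬ ¬ ∃ (HasDim¬¬ P)
  dim¬¬ P P⊆S = ⊆span⇒¬¬HasDim¬¬ P (proj₁ S-dim) (λ v → pure ∘ proj₂ (proj₂ (proj₂ S-dim)) v ∘ P⊆S v)

  S-sub : IsSubspace S
  S-sub = Span-isSubspace ⋃π

  𝒮⊆S : ∀ M v → 𝒮 M v → S v
  𝒮⊆S M = ⨁-least {M = M} S-sub (λ _ → π̂⊆S _)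

  𝒥⊆S : ∀ a v → 𝒥 a v → S v
  𝒥⊆S a = ⨁-least {M = a} S-sub (λ _ v → π̂⊆S a v ∘ proj₁)

  ℐ⊆S : ∀ M v → ℐ M v → S v
  ℐ⊆S M = ⨁-least {M = M} S-sub (λ {a} _ → 𝒥⊆S a)

  growth¬¬ : ∀ {M s s' i i' ℓ'} {X : Pred Carrierᴹ ℓ'} {x} → M < n →
    HasDim¬¬ (𝒮 M) s → HasDim¬¬ (𝒮 (suc M)) s' → HasDim¬¬ (ℐ M) i → HasDim¬¬ (ℐ (suc M)) i' →
    (∀ v → X v → ¬ ¬ (ℐ M ∩ 𝒥 M) v) → HasDim¬¬ X x → ¬ ¬ (s' + i' + x ≤ s + i + k)
  growth¬¬ {M} {s} M<n dim𝒮 dim𝒮' dimℐ dimℐ' X⊆ℐ∩𝒥 dimX = do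
    (σ , dim𝒮∩π̂) ← dim¬¬ (𝒮 M ∩ π̂ M) (λ v → 𝒮⊆S M v ∘ proj₁)
    (ρ , dimℐ∩𝒥) ← dim¬¬ (ℐ M ∩ 𝒥 M) (λ v → ℐ⊆S M v ∘ proj₁)
    (j , dim𝒥)   ← dim¬¬ (𝒥 M) (𝒥⊆S M)
    s'+σ≤s+k ← grassmann-≤ dim𝒮' dim𝒮 (π̂-dim M<n) dim𝒮∩π̂
    i'+ρ≤i+j ← grassmann-≤ dimℐ' dimℐ dim𝒥 dimℐ∩𝒥
    j≤σ ← dim-mono (λ v → pure ∘ 𝒥⊆𝒮∩π̂ M<n v) dim𝒥 dim𝒮∩π̂
    x≤ρ ← dim-mono X⊆ℐ∩𝒥 dimX dimℐ∩𝒥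
    pure (growth-bound {s = s} s'+σ≤s+k i'+ρ≤i+j j≤σ x≤ρ)

  IsSunflower : ℕ → Set (m ⊔ ℓ)
  IsSunflower M = ∀ {p q o} → p < M → q < M → o < M → p ≢ q → ∀ v → π̂ p v → π̂ q v → ¬ ¬ π̂ o v

  record NonSunflower (M : ℕ) : Set (m ⊔ ℓ) where
    field
      {p q o} : ℕ
      p<M : p < M
      q<M : q < M
      o<M : o < M
      p≢q : p ≢ q
      v : Carrierᴹ
      v∈π̂p : π̂ p v
      v∈π̂q : π̂ q v
      v∉π̂o : ¬ π̂ o v

  ¬IsSunflower⇒¬¬NonSunflower : ∀ {M} → ¬ IsSunflower M → ¬ ¬ NonSunflower M
  ¬IsSunflower⇒¬¬NonSunflower ¬sunflower ¬witness =
    ¬sunflower λ p<M q<M o<M p≢q v v∈π̂p v∈π̂q v∉π̂o → ¬witness (record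
      { p<M = p<M ; q<M = q<M ; o<M = o<M ; p≢q = p≢q ; v = v ; v∈π̂p = v∈π̂p ; v∈π̂q = v∈π̂q ; v∉π̂o = v∉π̂o })

  IsSunflower-suc⁻ : ∀ {M} → IsSunflower (suc M) → IsSunflower M
  IsSunflower-suc⁻ sunflower p<M q<M o<M =
    sunflower (ℕₚ.m<n⇒m<1+n p<M) (ℕₚ.m<n⇒m<1+n q<M) (ℕₚ.m<n⇒m<1+n o<M)

  Bound : ℕ → Set (r ⊔ ℓr ⊔ m ⊔ ℓm ⊔ ℓ)
  Bound j = ∀ {s i} → HasDim¬¬ (𝒮 (2 + j)) s → HasDim¬¬ (ℐ (2 + j)) i →
    ¬ ¬ (s + i + j ≤ 1 + bound k t j) × (IsSunflower (2 + j) → ¬ ¬ (s + i + j ≤ bound k t j))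

  bound-base : 2 ≤ n → Bound 0
  bound-base 2≤n {s} {i} dim𝒮 dimℐ = ¬¬-map ℕₚ.m≤n⇒m≤1+n s+i≤2k , λ _ → s+i≤2k
    where
    0<n = ℕₚ.<-trans (s≤s z≤n) 2≤n
    1<n = 2≤n
    π̂₀+π̂₁-sub = +ᴾ-isSubspace (π̂-sub 0<n) (π̂-sub 1<n)
    𝒮₂⊆π̂₀+π̂₁ : ∀ v → 𝒮 2 v → (π̂ 0 +ᴾ π̂ 1) v
    𝒮₂⊆π̂₀+π̂₁ = ⨁-least {f = π̂} {M = 2} π̂₀+π̂₁-sub λ
      { (s≤s z≤n)       _ → +ᴾ-upperˡ (π̂-sub 1<n)
      ; (s≤s (s≤s z≤n)) _ → +ᴾ-upperʳ (π̂-sub 0<n) }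
    ℐ₂⊆π̂₁∩π̂₀ : ∀ v → ℐ 2 v → (π̂ 1 ∩ π̂ 0) v
    ℐ₂⊆π̂₁∩π̂₀ = ℐ-least {M = 2} (π̂∩π̂-sub 1<n 0<n) λ { (s≤s z≤n) (s≤s (s≤s z≤n)) _ v∈ → v∈ }
    s+i≤2k : ¬ ¬ (s + i + 0 ≤ bound k t 0)
    s+i≤2k = do
      (δ , dimπ̂₀+π̂₁) ← dim¬¬ (π̂ 0 +ᴾ π̂ 1) (+ᴾ-least S-sub (π̂⊆S 0) (π̂⊆S 1))
      δ+c≤2k ← grassmann-≤ dimπ̂₀+π̂₁ (π̂-dim 0<n) (π̂-dim 1<n) (π̂-∩-dim 0<n 1<n (λ ()))
      s≤δ ← dim-mono (λ v → pure ∘ 𝒮₂⊆π̂₀+π̂₁ v) dim𝒮 dimπ̂₀+π̂₁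
      i≤c ← dim-mono (λ v → pure ∘ ℐ₂⊆π̂₁∩π̂₀ v) dimℐ (π̂-∩-dim 1<n 0<n (λ ()))
      pure (base-step {s = s} {k = k} t s≤δ i≤c δ+c≤2k)

  -- X := (π̂ M ∩ π̂ p) ∩ Y lies in ℐ M ∩ 𝒥 M, and Grassmann inside π̂ p gives dim X ≥ c + dim Y - k.
  step-via : ∀ {j p e ℓ'} {Y : Pred Carrierᴹ ℓ'} {y} → 2 + j < n → p < 2 + j →
    IsSubspace Y → (∀ v → Y v → π̂ p v) → (∀ v → Y v → ℐ (2 + j) v) → HasDim¬¬ Y y → e + c ≤ y →
    ∀ {s i s' i'} → HasDim¬¬ (𝒮 (2 + j)) s → HasDim¬¬ (ℐ (2 + j)) i →
    HasDim¬¬ (𝒮 (3 + j)) s' → HasDim¬¬ (ℐ (3 + j)) i' →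
    ¬ ¬ (s + i + j ≤ e + bound k t j) → ¬ ¬ (s' + i' + suc j ≤ 1 + bound k t (suc j))
  step-via {j} {p} {Y = Y} M<n p<M Y-sub Y⊆π̂p Y⊆ℐ dimY e+c≤y {s} {i} {s'} {i'} dim𝒮 dimℐ dim𝒮' dimℐ' IH = do
    (x , dimX)   ← dim¬¬ (P ∩ Y) (λ v → π̂⊆S M v ∘ proj₁ ∘ proj₁)
    (δ , dimP+Y) ← dim¬¬ (P +ᴾ Y) (+ᴾ-least S-sub (λ v → π̂⊆S M v ∘ proj₁) (λ v → π̂⊆S p v ∘ Y⊆π̂p v))
    c+y≤δ+x ← grassmann-≥ dimP+Y P-sub Y-sub dimP dimY dimX
    δ≤k ← dim-mono (λ v → pure ∘ +ᴾ-least (π̂-sub p<n) (λ _ → proj₂) Y⊆π̂p v) dimP+Y (π̂-dim p<n)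
    grows ← growth¬¬ M<n dim𝒮 dim𝒮' dimℐ dimℐ' X⊆ℐ∩𝒥 dimX
    ih ← IH
    pure (general-step {s} {s'} {i} {i'} grows c+y≤δ+x δ≤k e+c≤y ih)
    where
    M = 2 + j
    p<n = ℕₚ.<-trans p<M M<n
    P = π̂ M ∩ π̂ p
    P-sub = π̂∩π̂-sub M<n p<n
    dimP = π̂-∩-dim M<n p<n (λ M≡p → ℕₚ.<-irrefl (≡.sym M≡p) p<M)
    X⊆ℐ∩𝒥 : ∀ v → (P ∩ Y) v → ¬ ¬ (ℐ M ∩ 𝒥 M) v
    X⊆ℐ∩𝒥 v (v∈P , v∈Y) = pure (Y⊆ℐ v v∈Y , ∩⊆𝒥 p<M M<n v∈P)

  module Step (1≤t : 1 ≤ t) {j} (M<n : 2 + j < n) (IH : Bound j) where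

    private
      M = 2 + j
      M≤n = ℕₚ.<⇒≤ M<n
      0<M : 0 < M
      0<M = s≤s z≤n
      1<M : 1 < M
      1<M = s≤s (s≤s z≤n)
      0<n = ℕₚ.<-trans 0<M M<n
      1<n = ℕₚ.<-trans 1<M M<n
      π̂₀∩π̂₁-dim = π̂-∩-dim 0<n 1<n (λ ())

      with-dims : ∀ {ℓ'} {R : Set ℓ'} → (∀ {s i} → HasDim¬¬ (𝒮 M) s → HasDim¬¬ (ℐ M) i → ¬ ¬ R) → ¬ ¬ R
      with-dims f = do
        (_ , dim𝒮) ← dim¬¬ (𝒮 M) (𝒮⊆S M)
        (_ , dimℐ) ← dim¬¬ (ℐ M) (ℐ⊆S M)
        f dim𝒮 dimℐ

    module _ {s' i'} (dim𝒮' : HasDim¬¬ (𝒮 (suc M)) s') (dimℐ' : HasDim¬¬ (ℐ (suc M)) i') where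

      -- If π̂ M also contains π̂ 0 ∩ π̂ 1, that whole c-dimensional space lies in ℐ M ∩ 𝒥 M.
      sunflower-case : IsSunflower (suc M) → ¬ ¬ (s' + i' + suc j ≤ bound k t (suc j))
      sunflower-case sunflower = with-dims λ {s} {i} dim𝒮 dimℐ → do
        grows ← growth¬¬ M<n dim𝒮 dim𝒮' dimℐ dimℐ' π̂₀∩π̂₁⊆ℐ∩𝒥 π̂₀∩π̂₁-dim
        ih ← proj₂ (IH dim𝒮 dimℐ) (IsSunflower-suc⁻ sunflower)
        pure (sunflower-step {s} {s'} {i} {i'} grows ih 1≤t)
        where
        π̂₀∩π̂₁⊆ℐ∩𝒥 : ∀ v → (π̂ 0 ∩ π̂ 1) v → ¬ ¬ (ℐ M ∩ 𝒥 M) v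
        π̂₀∩π̂₁⊆ℐ∩𝒥 v (v∈π̂₀ , v∈π̂₁) = do
          v∈π̂M ← sunflower (ℕₚ.m<n⇒m<1+n 0<M) (ℕₚ.m<n⇒m<1+n 1<M) ℕₚ.≤-refl (λ ()) v v∈π̂₀ v∈π̂₁
          pure (∩⊆ℐ 0<M 1<M (λ ()) M≤n (v∈π̂₀ , v∈π̂₁) , ∩⊆𝒥 0<M M<n (v∈π̂M , v∈π̂₀))

      prefix-sunflower-case : IsSunflower M → ¬ ¬ (s' + i' + suc j ≤ 1 + bound k t (suc j))
      prefix-sunflower-case sunflower = with-dims λ dim𝒮 dimℐ →
        step-via M<n 0<M (π̂∩π̂-sub 0<n 1<n) (λ _ → proj₁) (λ _ → ∩⊆ℐ 0<M 1<M (λ ()) M≤n) π̂₀∩π̂₁-dim ℕₚ.≤-refl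
          dim𝒮 dimℐ dim𝒮' dimℐ' (proj₂ (IH dim𝒮 dimℐ) sunflower)

      -- A vector of π̂ p ∩ π̂ q outside π̂ o makes Y := π̂ p ∩ π̂ q + π̂ p ∩ π̂ o of dimension > c.
      non-sunflower-case : NonSunflower M → ¬ ¬ (s' + i' + suc j ≤ 1 + bound k t (suc j))
      non-sunflower-case w = with-dims λ dim𝒮 dimℐ → do
        (y , dimY) ← dim¬¬ Y (λ v → π̂⊆S p v ∘ Y⊆π̂p v)
        c<y ← dim-strict (π̂∩π̂-sub p<n o<n) (λ _ → pure ∘ +ᴾ-upperʳ (π̂∩π̂-sub p<n q<n))
          (+ᴾ-upperˡ (π̂∩π̂-sub p<n o<n) (v∈π̂p , v∈π̂q)) (v∉π̂o ∘ proj₂) (π̂-∩-dim p<n o<n p≢o) dimY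
        step-via M<n p<M Y-sub Y⊆π̂p Y⊆ℐ dimY c<y dim𝒮 dimℐ dim𝒮' dimℐ' (proj₁ (IH dim𝒮 dimℐ))
        where
        open NonSunflower w
        p<n = ℕₚ.<-trans p<M M<n
        q<n = ℕₚ.<-trans q<M M<n
        o<n = ℕₚ.<-trans o<M M<n
        p≢o : p ≢ o
        p≢o p≡o = v∉π̂o (≡.subst (λ a → π̂ a v) p≡o v∈π̂p)
        Y = (π̂ p ∩ π̂ q) +ᴾ (π̂ p ∩ π̂ o)
        Y-sub = +ᴾ-isSubspace (π̂∩π̂-sub p<n q<n) (π̂∩π̂-sub p<n o<n)
        Y⊆π̂p : ∀ v → Y v → π̂ p v
        Y⊆π̂p = +ᴾ-least (π̂-sub p<n) (λ _ → proj₁) (λ _ → proj₁)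
        Y⊆ℐ : ∀ v → Y v → ℐ M v
        Y⊆ℐ = +ᴾ-least (ℐ-sub M≤n) (λ _ → ∩⊆ℐ p<M q<M p≢q M≤n) (λ _ → ∩⊆ℐ p<M o<M p≢o M≤n)

      bound-suc : ¬ ¬ (s' + i' + suc j ≤ 1 + bound k t (suc j))
      bound-suc = do
        no ¬sunflower ← ¬¬-excluded-middle {A = IsSunflower M}
          where yes sunflower → prefix-sunflower-case sunflower
        w ← ¬IsSunflower⇒¬¬NonSunflower ¬sunflower
        non-sunflower-case w

  bound-holds : 1 ≤ t → ∀ j → 2 + j ≤ n → Bound j
  bound-holds 1≤t zero    2≤n   = bound-base 2≤n
  bound-holds 1≤t (suc j) 3+j≤n dim𝒮 dimℐ = bound-suc dim𝒮 dimℐ , sunflower-case dim𝒮 dimℐ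
    where open Step 1≤t 3+j≤n (bound-holds 1≤t j (ℕₚ.<⇒≤ 3+j≤n))

  Pairs : Pred Carrierᴹ ℓ
  Pairs v = ∃ λ i → ∃ λ j → i <ᶠ j × π i v × π j v

  scid-bound : 1 ≤ t → ∀ {j dI} → n ≡ 2 + j → HasDim (Span Pairs) dI → ¬ ¬ (dS + dI + j ≤ 1 + bound k t j)
  scid-bound 1≤t {j} ≡.refl I-dim = do
    (s , dim𝒮) ← dim¬¬ (𝒮 n) (𝒮⊆S n)
    (i , dimℐ) ← dim¬¬ (ℐ n) (ℐ⊆S n)
    s+i+j≤ ← proj₁ (bound-holds 1≤t j ℕₚ.≤-refl dim𝒮 dimℐ)
    dS≤s ← dim-mono (Span-least¬¬ ⋃π (𝒮-sub ℕₚ.≤-refl) ⋃π⊆𝒮) (HasDim⇒HasDim¬¬ S-dim) dim𝒮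
    dI≤i ← dim-mono (Span-least¬¬ Pairs (ℐ-sub ℕₚ.≤-refl) Pairs⊆ℐ) (HasDim⇒HasDim¬¬ I-dim) dimℐ
    pure (ℕₚ.≤-trans (ℕₚ.+-monoˡ-≤ j (ℕₚ.+-mono-≤ dS≤s dI≤i)) s+i+j≤)
    where
    ⋃π⊆𝒮 : ∀ v → ⋃π v → ¬ ¬ 𝒮 n v
    ⋃π⊆𝒮 v (f , v∈πf) = pure (π̂⊆𝒮 (toℕ<n f) ℕₚ.≤-refl (f , ≡.refl , v∈πf))
    Pairs⊆ℐ : ∀ v → Pairs v → ¬ ¬ ℐ n v
    Pairs⊆ℐ v (f , g , f<g , v∈πf , v∈πg) =
      pure (∩⊆ℐ (toℕ<n f) (toℕ<n g) (ℕₚ.<⇒≢ f<g) ℕₚ.≤-refl ((f , ≡.refl , v∈πf) , (g , ≡.refl , v∈πg)))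

theorem4 : ∀ {r ℓr m ℓm ℓ} (F : CommutativeRing r ℓr) → IsField F → IsFinite F →
    (V : Module F m ℓm) →
    let open VectorSpace V in
    (k t : ℕ) → t ≤ k → 2 * t ≤ k → (n : ℕ) → 3 ≤ n →
    (π : Fin n → Pred (Module.Carrierᴹ V) ℓ) →
    (∀ i → IsSubspace (π i)) →
    (∀ i → HasDim (π i) k) →
    (∀ i j → i ≢ j → ¬ SameSet (π i) (π j)) →
    (∀ i j → i ≢ j → HasDim (π i ∩ π j) (k ∸ t)) →
    (dS dI : ℕ) →
    HasDim (Span (λ v → ∃ λ i → π i v)) dS →
    HasDim (Span (λ v → ∃ λ i → ∃ λ j → i <ᶠ j × π i v × π j v)) dI →
    dS + dI + (n ∸ 3) ≤ 2 * k + 2 * (n ∸ 2) * t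
theorem4 F isField _ V k zero _ _ _ (s≤s (s≤s (s≤s _))) π π-sub π-dim π-distinct π-∩-dim _ _ _ _ =
  ⊥-elim (∩-dim-equal⇒SameSet (π-sub i₀) (π-sub i₁) (π-dim i₀) (π-dim i₁) (π-∩-dim i₀ i₁ (λ ()))
    (π-distinct i₀ i₁ (λ ())))
  where
  open LinearAlgebra isField V
  i₀ i₁ : Fin _
  i₀ = fzero
  i₁ = fsuc fzero
theorem4 F isField _ V k t@(suc _) t≤k _ n@(suc (suc (suc j))) (s≤s (s≤s (s≤s _))) π π-sub π-dim _ π-∩-dim
         dS dI S-dim I-dim =
  ≡.subst (λ k → dS + dI + j ≤ 2 * k + 2 * (n ∸ 2) * t) c+t≡k
    (drop-suc (¬¬-≤-stable (scid-bound (s≤s z≤n) ≡.refl I-dim)))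
  where
  c = k ∸ t
  c+t≡k = ℕₚ.m∸n+n≡m t≤k
  open Arithmetic using (drop-suc)
  open SCID isField V π π-sub c t (λ i → ≡.subst (VectorSpace.HasDim V (π i)) (≡.sym c+t≡k) (π-dim i)) π-∩-dim S-dim
    using (scid-bound)
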